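{- There exists a constant $\zeta>0$ such that for all $\delta\in(0,1)$ and all integers $L\ge 2$, there is an explicit function $\omega:\{1,\dots,L\}\to\mathbb{R}$ with: (1) $\omega(1)\ge\frac{1-\delta}{2}$; (2) $-\omega(2)\ge\frac{1-\delta}{2}$; (3) $\sum_{k=1}^L|\omega(k)|=1$; (4) for every polynomial $p:\{1,\dots,L\}\to\mathbb{R}$ of degree $d\le\zeta\sqrt{\delta L}$, $\sum_{k=1}^L p(k)\omega(k)=0$.
   Formalization: The parameter δ ranges over the rationals in (0,1) and the polynomials p have rational coefficients, while the constant ζ and the values of ω are taken in ℚ. -}

module Defs where

open import Data.Nat using (ℕ; zero; suc)
open import Data.Integer using (+_)
open import Data.Rational using (ℚ; 0ℚ; _+_; _*_; _/_)
open import Data.Vec using (Vec; []; _∷_)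

ℕ→ℚ : ℕ → ℚ
ℕ→ℚ n = + n / 1

sum1to : ℕ → (ℕ → ℚ) → ℚ
sum1to zero    f = 0ℚ
sum1to (suc n) f = sum1to n f + f (suc n)

-- polynomial with coefficient vector (c₀, c₁, …, c_d), i.e. degree ≤ d,
-- evaluated at x:  c₀ + c₁ x + … + c_d x^d  (Horner form)
evalPoly : ∀ {m} → Vec ℚ m → ℚ → ℚ
evalPoly []       x = 0ℚ
evalPoly (c ∷ cs) x = c + x * evalPoly cs x

-- Let e ≈ 8/δ and let D be maximal with 1 + (e+1)D² ≤ L. The 2D+1 nodes
-- N_k = 1 + (e+1)(k − D)², 0 ≤ k ≤ 2D, lie in [1, L], with N_D = 1 and N_k ≥ e + 2 > 2
-- otherwise. With weights w_k = (−1)^(D+k) C(2D,k) / (N_k − 2) put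
-- ω = Σ_k w_k (e₂ − e_{N_k}). Pairing ω with a polynomial p of degree ≤ D gives
-- −(−1)^D Σ_k (−1)^k C(2D,k) q(N_k), where q = (p − p(2))/(x − 2); as k ↦ q(N_k) is a
-- polynomial of degree < 2D, this 2D-th finite difference vanishes. Since C(2D,k) ≤ C(2D,D)
-- and Σ 1/m² ≤ 2, all weights but w_D = −C(2D,D) have total size ≤ 4C(2D,D)/e ≤ δC(2D,D)/2,
-- so ω(1) = C(2D,D) and −ω(2) ≥ (1 − δ/2)C(2D,D) carry almost all of the ℓ¹-mass of ω, and
-- ω/‖ω‖₁ is the required function. With ζ = 1/5, d² ≤ δL/25 forces 1 + (e+1)d² ≤ L, i.e. d ≤ D.

module Submission where

open import Defs
open import Algebra.Bundles using (CommutativeMonoid)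
open import Data.Empty using (⊥-elim)
import Data.Integer as ℤ
import Data.Integer.Properties as ℤ
open import Data.Nat as ℕ using (ℕ; zero; suc; z≤n; s≤s) renaming (_≤_ to _≤ℕ_)
import Data.Nat.Properties as ℕ
open import Data.Nat.Combinatorics using (_C_; nC1≡n; nCk+nC[k+1]≡[n+1]C[k+1]; k>n⇒nCk≡0)
open import Data.Nat.Coprimality using (1-coprimeTo)
import Data.Nat.Coprimality as Coprime
open import Data.Nat.Tactic.RingSolver renaming (solve-∀ to ℕ-solve-∀)
open import Data.Product using (Σ; Σ-syntax; _×_; _,_)
open import Data.Rational
open import Data.Rational.Properties
import Data.Rational.Unnormalised as ℚᵘ
import Data.Rational.Unnormalised.Properties as ℚᵘ
open import Data.Sum using (inj₁; inj₂; [_,_]′)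
open import Data.Unit using (tt)
open import Data.Vec using (Vec; []; _∷_; replicate; zipWith; map)
open import Function using (_∘_)
open import Relation.Binary.PropositionalEquality
open import Relation.Nullary using (Dec; yes; no; contradiction)
open import Relation.Nullary.Decidable using (dec⇒maybe)
open import Relation.Unary using (Decidable)
open import Tactic.RingSolver using (solve-∀)
open import Tactic.RingSolver.Core.AlmostCommutativeRing using (AlmostCommutativeRing; fromCommutativeRing)

ℚ-ring : AlmostCommutativeRing _ _
ℚ-ring = fromCommutativeRing +-*-commutativeRing (λ x → dec⇒maybe (0ℚ ≟ x))

ℕ→ℚ≡mkℚ : ∀ n → ℕ→ℚ n ≡ mkℚ (ℤ.+ n) 0 (Coprime.sym (1-coprimeTo n))
ℕ→ℚ≡mkℚ n = ↥p/↧p≡p (mkℚ (ℤ.+ n) 0 (Coprime.sym (1-coprimeTo n)))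

ℕ→ℚ-+ : ∀ m n → ℕ→ℚ (m ℕ.+ n) ≡ ℕ→ℚ m + ℕ→ℚ n
ℕ→ℚ-+ m n rewrite ℕ→ℚ≡mkℚ m | ℕ→ℚ≡mkℚ n =
  cong (_/ 1) (trans (ℤ.pos-+ m n) (sym (cong₂ ℤ._+_ (ℤ.*-identityʳ (ℤ.+ m)) (ℤ.*-identityʳ (ℤ.+ n)))))

ℕ→ℚ-suc : ∀ k → ℕ→ℚ (suc k) ≡ ℕ→ℚ k + 1ℚ
ℕ→ℚ-suc k = trans (cong ℕ→ℚ (ℕ.+-comm 1 k)) (ℕ→ℚ-+ k 1)

ℕ→ℚ-* : ∀ m n → ℕ→ℚ (m ℕ.* n) ≡ ℕ→ℚ m * ℕ→ℚ n
ℕ→ℚ-* m n rewrite ℕ→ℚ≡mkℚ m | ℕ→ℚ≡mkℚ n = cong (_/ 1) (ℤ.pos-* m n)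

ℕ→ℚ-mono-≤ : ∀ {m n} → m ≤ℕ n → ℕ→ℚ m ≤ ℕ→ℚ n
ℕ→ℚ-mono-≤ {m} {n} m≤n rewrite ℕ→ℚ≡mkℚ m | ℕ→ℚ≡mkℚ n =
  *≤* (subst₂ ℤ._≤_ (sym (ℤ.*-identityʳ (ℤ.+ m))) (sym (ℤ.*-identityʳ (ℤ.+ n))) (ℤ.+≤+ m≤n))

ℕ→ℚ-cancel-≤ : ∀ {m n} → ℕ→ℚ m ≤ ℕ→ℚ n → m ≤ℕ n
ℕ→ℚ-cancel-≤ {m} {n} le rewrite ℕ→ℚ≡mkℚ m | ℕ→ℚ≡mkℚ n =
  ℤ.drop‿+≤+ (subst₂ ℤ._≤_ (ℤ.*-identityʳ (ℤ.+ m)) (ℤ.*-identityʳ (ℤ.+ n)) (drop-*≤* le))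

ℕ→ℚ-injective : ∀ {m n} → ℕ→ℚ m ≡ ℕ→ℚ n → m ≡ n
ℕ→ℚ-injective eq = ℕ.≤-antisym (ℕ→ℚ-cancel-≤ (≤-reflexive eq)) (ℕ→ℚ-cancel-≤ (≤-reflexive (sym eq)))

ℕ→ℚ-nonNeg : ∀ n → 0ℚ ≤ ℕ→ℚ n
ℕ→ℚ-nonNeg n = ℕ→ℚ-mono-≤ {0} {n} z≤n

ℕ→ℚ-pos : ∀ {n} → 0 ℕ.< n → 0ℚ < ℕ→ℚ n
ℕ→ℚ-pos {n} 0<n rewrite ℕ→ℚ≡mkℚ n =
  *<* (subst (ℤ.+ 0 ℤ.<_) (sym (ℤ.*-identityʳ (ℤ.+ n))) (ℤ.+<+ 0<n))

+-nonNeg : ∀ {a b} → 0ℚ ≤ a → 0ℚ ≤ b → 0ℚ ≤ a + b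
+-nonNeg {a} {b} 0≤a 0≤b = subst (_≤ a + b) (+-identityʳ 0ℚ) (+-mono-≤ 0≤a 0≤b)

*-nonNeg : ∀ {a b} → 0ℚ ≤ a → 0ℚ ≤ b → 0ℚ ≤ a * b
*-nonNeg {a} {b} 0≤a 0≤b =
  nonNegative⁻¹ (a * b) {{nonNeg*nonNeg⇒nonNeg a {{nonNegative 0≤a}} b {{nonNegative 0≤b}}}}

*-monoˡ-≤ : ∀ {r p q} → 0ℚ ≤ r → p ≤ q → r * p ≤ r * q
*-monoˡ-≤ {r} 0≤r = *-monoˡ-≤-nonNeg r {{nonNegative 0≤r}}

*-monoʳ-≤ : ∀ {r p q} → 0ℚ ≤ r → p ≤ q → p * r ≤ q * r
*-monoʳ-≤ {r} 0≤r = *-monoʳ-≤-nonNeg r {{nonNegative 0≤r}}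

*-pos : ∀ {a b} → 0ℚ < a → 0ℚ < b → 0ℚ < a * b
*-pos {a} {b} 0<a 0<b = positive⁻¹ (a * b) {{pos*pos⇒pos a {{positive 0<a}} b {{positive 0<b}}}}

p≤q⇒0≤q-p : ∀ {p q} → p ≤ q → 0ℚ ≤ q - p
p≤q⇒0≤q-p {p} {q} p≤q = subst (_≤ q - p) (+-inverseʳ p) (+-monoˡ-≤ (- p) p≤q)

≤-by : ∀ {x y} d → 0ℚ ≤ d → x + d ≡ y → x ≤ y
≤-by {x} d 0≤d x+d≡y = subst (x ≤_) x+d≡y (subst (_≤ x + d) (+-identityʳ x) (+-monoʳ-≤ x 0≤d))

0≤∣p∣-p : ∀ p → 0ℚ ≤ ∣ p ∣ - p
0≤∣p∣-p p with ∣p∣≡p∨∣p∣≡-p p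
... | inj₁ ∣p∣≡p  = ≤-reflexive (sym (trans (cong (_- p) ∣p∣≡p) (+-inverseʳ p)))
... | inj₂ ∣p∣≡-p = subst (0ℚ ≤_) (cong (∣ p ∣ +_) ∣p∣≡-p) (+-nonNeg (0≤∣p∣ p) (0≤∣p∣ p))

1/-pos : ∀ {d} (0<d : 0ℚ < d) → 0ℚ < (1/ d) {{>-nonZero 0<d}}
1/-pos {d} 0<d = positive⁻¹ _ {{1/pos⇒pos d {{positive 0<d}}}}

*1/-≤ : ∀ {a x d} (0<d : 0ℚ < d) → a ≤ x * d → a * (1/ d) {{>-nonZero 0<d}} ≤ x
*1/-≤ {a} {x} {d} 0<d a≤xd = begin
  a * 1/d        ≤⟨ *-monoʳ-≤ (<⇒≤ (1/-pos 0<d)) a≤xd ⟩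
  x * d * 1/d    ≡⟨ trans (*-assoc x d 1/d) (cong (x *_) (*-inverseʳ d {{>-nonZero 0<d}})) ⟩
  x * 1ℚ         ≡⟨ *-identityʳ x ⟩
  x              ∎
  where
  open ≤-Reasoning
  1/d = (1/ d) {{>-nonZero 0<d}}

≤-*1/ : ∀ {a x d} (0<d : 0ℚ < d) → a * d ≤ x → a ≤ x * (1/ d) {{>-nonZero 0<d}}
≤-*1/ {a} {x} {d} 0<d ad≤x = begin
  a              ≡⟨ sym (trans (cong (a *_) (*-inverseʳ d {{>-nonZero 0<d}})) (*-identityʳ a)) ⟩
  a * (d * 1/d)  ≡⟨ sym (*-assoc a d 1/d) ⟩
  a * d * 1/d    ≤⟨ *-monoʳ-≤ (<⇒≤ (1/-pos 0<d)) ad≤x ⟩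
  x * 1/d        ∎
  where
  open ≤-Reasoning
  1/d = (1/ d) {{>-nonZero 0<d}}

1/[1+_] : ℕ → ℚ
1/[1+ n ] = (1/ ℕ→ℚ (suc n)) {{>-nonZero (ℕ→ℚ-pos {suc n} (s≤s z≤n))}}

[1+n]*1/[1+n]≡1 : ∀ n → ℕ→ℚ (suc n) * 1/[1+ n ] ≡ 1ℚ
[1+n]*1/[1+n]≡1 n = *-inverseʳ (ℕ→ℚ (suc n)) {{>-nonZero (ℕ→ℚ-pos {suc n} (s≤s z≤n))}}

1/[1+n]-pos : ∀ n → 0ℚ < 1/[1+ n ]
1/[1+n]-pos n = 1/-pos (ℕ→ℚ-pos {suc n} (s≤s z≤n))

∑ : ℕ → (ℕ → ℚ) → ℚ
∑ zero    f = 0ℚ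
∑ (suc n) f = f 0 + ∑ n (λ k → f (suc k))

syntax ∑ n (λ k → e) = ∑[ k < n ] e

∑-cong : ∀ n {f g : ℕ → ℚ} → (∀ k → k ℕ.< n → f k ≡ g k) → ∑ n f ≡ ∑ n g
∑-cong zero    eq = refl
∑-cong (suc n) eq = cong₂ _+_ (eq 0 (s≤s z≤n)) (∑-cong n (λ k k<n → eq (suc k) (s≤s k<n)))

∑-zero : ∀ n → ∑[ k < n ] 0ℚ ≡ 0ℚ
∑-zero zero    = refl
∑-zero (suc n) = trans (+-identityˡ _) (∑-zero n)

∑-*-zeroʳ : ∀ n {f : ℕ → ℚ} → ∑[ k < n ] (f k * 0ℚ) ≡ 0ℚ
∑-*-zeroʳ n {f} = trans (∑-cong n (λ k _ → *-zeroʳ (f k))) (∑-zero n)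

∑-+ : ∀ n (f g : ℕ → ℚ) → ∑[ k < n ] (f k + g k) ≡ ∑ n f + ∑ n g
∑-+ zero    f g = sym (+-identityˡ 0ℚ)
∑-+ (suc n) f g = trans (cong (f 0 + g 0 +_) (∑-+ n _ _)) (+-interchange (f 0) (g 0) _ _)
  where open import Algebra.Properties.CommutativeSemigroup (CommutativeMonoid.commutativeSemigroup +-0-commutativeMonoid)
          renaming (interchange to +-interchange)

∑-*ˡ : ∀ n a (f : ℕ → ℚ) → ∑[ k < n ] (a * f k) ≡ a * ∑ n f
∑-*ˡ zero    a f = sym (*-zeroʳ a)
∑-*ˡ (suc n) a f = trans (cong (a * f 0 +_) (∑-*ˡ n a _)) (sym (*-distribˡ-+ a (f 0) _))

∑-*ʳ : ∀ n a (f : ℕ → ℚ) → ∑[ k < n ] (f k * a) ≡ ∑ n f * a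
∑-*ʳ n a f = trans (∑-cong n (λ k _ → *-comm (f k) a)) (trans (∑-*ˡ n a f) (*-comm a _))

∑-neg : ∀ n (f : ℕ → ℚ) → ∑[ k < n ] (- f k) ≡ - ∑ n f
∑-neg zero    f = refl
∑-neg (suc n) f = trans (cong (- f 0 +_) (∑-neg n _)) (sym (neg-distrib-+ (f 0) _))

∑-- : ∀ n (f g : ℕ → ℚ) → ∑[ k < n ] (f k - g k) ≡ ∑ n f - ∑ n g
∑-- n f g = trans (∑-+ n f (λ k → - g k)) (cong (∑ n f +_) (∑-neg n g))

∑-snoc : ∀ n (f : ℕ → ℚ) → ∑ (suc n) f ≡ ∑ n f + f n
∑-snoc zero    f = trans (+-identityʳ (f 0)) (sym (+-identityˡ (f 0)))
∑-snoc (suc n) f = trans (cong (f 0 +_) (∑-snoc n _)) (sym (+-assoc (f 0) _ _))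

∑-++ : ∀ m n (f : ℕ → ℚ) → ∑ (m ℕ.+ n) f ≡ ∑ m f + ∑[ k < n ] f (m ℕ.+ k)
∑-++ zero    n f = sym (+-identityˡ _)
∑-++ (suc m) n f = trans (cong (f 0 +_) (∑-++ m n _)) (sym (+-assoc (f 0) _ _))

∑-reverse : ∀ n (f : ℕ → ℚ) → ∑[ k < n ] f (n ℕ.∸ k) ≡ ∑[ k < n ] f (suc k)
∑-reverse zero    f = refl
∑-reverse (suc n) f = begin
  f (suc n) + ∑[ k < n ] f (n ℕ.∸ k) ≡⟨ cong (f (suc n) +_) (∑-reverse n f) ⟩
  f (suc n) + ∑[ k < n ] f (suc k)   ≡⟨ +-comm (f (suc n)) _ ⟩
  ∑[ k < n ] f (suc k) + f (suc n)   ≡⟨ sym (∑-snoc n (λ k → f (suc k))) ⟩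
  ∑[ k < suc n ] f (suc k)           ∎
  where open ≡-Reasoning

∑-swap : ∀ m n (F : ℕ → ℕ → ℚ) → ∑[ i < m ] ∑[ j < n ] F i j ≡ ∑[ j < n ] ∑[ i < m ] F i j
∑-swap zero    n F = sym (∑-zero n)
∑-swap (suc m) n F = trans (cong (∑[ j < n ] F 0 j +_) (∑-swap m n _)) (sym (∑-+ n _ _))

∑-mono-≤ : ∀ n {f g : ℕ → ℚ} → (∀ k → f k ≤ g k) → ∑ n f ≤ ∑ n g
∑-mono-≤ zero    le = ≤-refl
∑-mono-≤ (suc n) le = +-mono-≤ (le 0) (∑-mono-≤ n (λ k → le (suc k)))

∑-nonNeg : ∀ n {f : ℕ → ℚ} → (∀ k → 0ℚ ≤ f k) → 0ℚ ≤ ∑ n f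
∑-nonNeg n {f} nonNeg = subst (_≤ ∑ n f) (∑-zero n) (∑-mono-≤ n nonNeg)

∑-term-≤ : ∀ n {f : ℕ → ℚ} → (∀ k → 0ℚ ≤ f k) → ∀ {j} → j ℕ.< n → f j ≤ ∑ n f
∑-term-≤ (suc n) {f} nonNeg {zero}  _         = subst (_≤ f 0 + ∑[ k < n ] f (suc k)) (+-identityʳ (f 0))
  (+-monoʳ-≤ (f 0) (∑-nonNeg n (λ k → nonNeg (suc k))))
∑-term-≤ (suc n) {f} nonNeg {suc j} (s≤s j<n) = subst (_≤ f 0 + ∑[ k < n ] f (suc k)) (+-identityˡ (f (suc j)))
  (+-mono-≤ (nonNeg 0) (∑-term-≤ n (λ k → nonNeg (suc k)) j<n))

∣∑∣≤∑∣∣ : ∀ n (f : ℕ → ℚ) → ∣ ∑ n f ∣ ≤ ∑[ k < n ] ∣ f k ∣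
∣∑∣≤∑∣∣ zero    f = ≤-refl
∣∑∣≤∑∣∣ (suc n) f = ≤-trans (∣p+q∣≤∣p∣+∣q∣ (f 0) _) (+-monoʳ-≤ ∣ f 0 ∣ (∣∑∣≤∑∣∣ n _))

-- Defined by recursion rather than through _≟_ so that 𝟙[ suc x ≡ suc y ] reduces to 𝟙[ x ≡ y ],
-- which lets sums over 1 … L be reindexed to sums over 0 … L − 1 for free.
𝟙[_≡_] : ℕ → ℕ → ℚ
𝟙[ zero  ≡ zero  ] = 1ℚ
𝟙[ suc x ≡ suc y ] = 𝟙[ x ≡ y ]
𝟙[ _     ≡ _     ] = 0ℚ

𝟙[x≡x] : ∀ x → 𝟙[ x ≡ x ] ≡ 1ℚ
𝟙[x≡x] zero    = refl
𝟙[x≡x] (suc x) = 𝟙[x≡x] x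

𝟙[x≢y] : ∀ {x y} → x ≢ y → 𝟙[ x ≡ y ] ≡ 0ℚ
𝟙[x≢y] {zero}  {zero}  x≢y = contradiction refl x≢y
𝟙[x≢y] {zero}  {suc y} _   = refl
𝟙[x≢y] {suc x} {zero}  _   = refl
𝟙[x≢y] {suc x} {suc y} x≢y = 𝟙[x≢y] (x≢y ∘ cong suc)

𝟙-nonNeg : ∀ x y → 0ℚ ≤ 𝟙[ x ≡ y ]
𝟙-nonNeg zero    zero    = ℕ→ℚ-nonNeg 1
𝟙-nonNeg (suc x) (suc y) = 𝟙-nonNeg x y
𝟙-nonNeg zero    (suc y) = ≤-refl
𝟙-nonNeg (suc x) zero    = ≤-refl

∑-𝟙 : ∀ n {y} (f : ℕ → ℚ) → y ℕ.< n → ∑[ x < n ] (f x * 𝟙[ x ≡ y ]) ≡ f y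
∑-𝟙 (suc n) {zero}  f _ = begin
  f 0 * 1ℚ + ∑[ x < n ] (f (suc x) * 0ℚ) ≡⟨ cong₂ _+_ (*-identityʳ (f 0)) (∑-*-zeroʳ n {λ x → f (suc x)}) ⟩
  f 0 + 0ℚ                                ≡⟨ +-identityʳ (f 0) ⟩
  f 0                                     ∎
  where open ≡-Reasoning
∑-𝟙 (suc n) {suc y} f (s≤s y<n) =
  trans (cong₂ _+_ (*-zeroʳ (f 0)) (∑-𝟙 n (λ x → f (suc x)) y<n)) (+-identityˡ (f (suc y)))

∑∑𝟙 : ∀ m n (F : ℕ → ℕ → ℚ) (y : ℕ → ℕ) → (∀ k → k ℕ.< n → y k ℕ.< m) →
      ∑[ x < m ] ∑[ k < n ] (F k x * 𝟙[ x ≡ y k ]) ≡ ∑[ k < n ] F k (y k)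
∑∑𝟙 m n F y y<m = trans (∑-swap m n _) (∑-cong n (λ k k<n → ∑-𝟙 m (F k) (y<m k k<n)))

sum1to≡∑ : ∀ n (f : ℕ → ℚ) → sum1to n f ≡ ∑[ k < n ] f (suc k)
sum1to≡∑ zero    f = refl
sum1to≡∑ (suc n) f = trans (cong (_+ f (suc n)) (sum1to≡∑ n f)) (sym (∑-snoc n (λ k → f (suc k))))

sum1to-cong : ∀ n {f g : ℕ → ℚ} → (∀ k → f k ≡ g k) → sum1to n f ≡ sum1to n g
sum1to-cong zero    f≡g = refl
sum1to-cong (suc n) f≡g = cong₂ _+_ (sum1to-cong n f≡g) (f≡g (suc n))

sum1to-*ʳ : ∀ n a (f : ℕ → ℚ) → sum1to n (λ k → f k * a) ≡ sum1to n f * a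
sum1to-*ʳ n a f = begin
  sum1to n (λ k → f k * a)   ≡⟨ sum1to≡∑ n (λ k → f k * a) ⟩
  ∑[ k < n ] (f (suc k) * a) ≡⟨ ∑-*ʳ n a (λ k → f (suc k)) ⟩
  ∑[ k < n ] f (suc k) * a   ≡⟨ cong (_* a) (sym (sum1to≡∑ n f)) ⟩
  sum1to n f * a             ∎
  where open ≡-Reasoning

ℕ→ℚ-1+c*n² : ∀ c n → ℕ→ℚ (suc (c ℕ.* (n ℕ.* n))) ≡ ℕ→ℚ c * (ℕ→ℚ n * ℕ→ℚ n) + 1ℚ
ℕ→ℚ-1+c*n² c n =
  trans (ℕ→ℚ-suc (c ℕ.* (n ℕ.* n))) (cong (_+ 1ℚ) (trans (ℕ→ℚ-* c (n ℕ.* n)) (cong (ℕ→ℚ c *_) (ℕ→ℚ-* n n))))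

ℕ→ℚ-∣m-n∣² : ∀ m n → ℕ→ℚ ℕ.∣ m - n ∣ * ℕ→ℚ ℕ.∣ m - n ∣ ≡ (ℕ→ℚ m - ℕ→ℚ n) * (ℕ→ℚ m - ℕ→ℚ n)
ℕ→ℚ-∣m-n∣² m n = [ (λ m≤n → subst (Square m) (ℕ.m+[n∸m]≡n m≤n) (below m (n ℕ.∸ m)))
                 , (λ n≤m → subst (λ m → Square m n) (ℕ.m+[n∸m]≡n n≤m) (above n (m ℕ.∸ n)))
                 ]′ (ℕ.≤-total m n)
  where
  Square : ℕ → ℕ → Set
  Square m n = ℕ→ℚ ℕ.∣ m - n ∣ * ℕ→ℚ ℕ.∣ m - n ∣ ≡ (ℕ→ℚ m - ℕ→ℚ n) * (ℕ→ℚ m - ℕ→ℚ n)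
  square-below : ∀ a b → b * b ≡ (a - (a + b)) * (a - (a + b))
  square-below = solve-∀ ℚ-ring
  square-above : ∀ a b → b * b ≡ ((a + b) - a) * ((a + b) - a)
  square-above = solve-∀ ℚ-ring
  below : ∀ m j → Square m (m ℕ.+ j)
  below m j rewrite ℕ.∣m-m+n∣≡n m j | ℕ→ℚ-+ m j = square-below (ℕ→ℚ m) (ℕ→ℚ j)
  above : ∀ n j → Square (n ℕ.+ j) n
  above n j rewrite ℕ.∣-∣-comm (n ℕ.+ j) n | ℕ.∣m-m+n∣≡n n j | ℕ→ℚ-+ n j = square-above (ℕ→ℚ n) (ℕ→ℚ j)

∑-distance : ∀ D (h : ℕ → ℚ) →
             ∑[ k < suc (D ℕ.+ D) ] h ℕ.∣ k - D ∣ ≡ h 0 + (∑[ j < D ] h (suc j) + ∑[ j < D ] h (suc j))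
∑-distance D h = begin
  ∑[ k < suc (D ℕ.+ D) ] h ℕ.∣ k - D ∣                          ≡⟨ cong (λ n → ∑[ k < n ] h ℕ.∣ k - D ∣) (sym (ℕ.+-suc D D)) ⟩
  ∑[ k < D ℕ.+ suc D ] h ℕ.∣ k - D ∣                            ≡⟨ ∑-++ D (suc D) (λ k → h ℕ.∣ k - D ∣) ⟩
  ∑[ k < D ] h ℕ.∣ k - D ∣ + ∑[ j < suc D ] h ℕ.∣ D ℕ.+ j - D ∣ ≡⟨ cong₂ _+_ left right ⟩
  S + (h 0 + S)                                                 ≡⟨ x+[y+z]≡y+[x+z] S (h 0) S ⟩
  h 0 + (S + S)                                                 ∎
  where
  open ≡-Reasoning
  S = ∑[ j < D ] h (suc j)
  left : ∑[ k < D ] h ℕ.∣ k - D ∣ ≡ S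
  left = trans (∑-cong D (λ k k<D → cong h (ℕ.m≤n⇒∣m-n∣≡n∸m (ℕ.<⇒≤ k<D)))) (∑-reverse D h)
  right : ∑[ j < suc D ] h ℕ.∣ D ℕ.+ j - D ∣ ≡ h 0 + S
  right = ∑-cong (suc D) (λ j _ → cong h (trans (ℕ.∣-∣-comm (D ℕ.+ j) D) (ℕ.∣m-m+n∣≡n D j)))
  x+[y+z]≡y+[x+z] : ∀ x y z → x + (y + z) ≡ y + (x + z)
  x+[y+z]≡y+[x+z] = solve-∀ ℚ-ring

-- Clearing the denominators a²(a + 1), where a = n + 1, leaves a + 1 ≤ 2a.
1/[1+n]²+2/[2+n]≤2/[1+n] : ∀ n → 1/[1+ n ] * 1/[1+ n ] + ℕ→ℚ 2 * 1/[1+ suc n ] ≤ ℕ→ℚ 2 * 1/[1+ n ]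
1/[1+n]²+2/[2+n]≤2/[1+n] n = *-cancelʳ-≤-pos P {{positive 0<P}} (begin
  (l * l + ℕ→ℚ 2 * l′) * P
    ≡⟨ expand-left a l l′ ⟩
  (a * l) * (a * l) * (a + 1ℚ) + ℕ→ℚ 2 * (a * a) * ((a + 1ℚ) * l′)
    ≡⟨ cong₂ (λ u v → u * u * (a + 1ℚ) + ℕ→ℚ 2 * (a * a) * v) al≡1 a′l′≡1 ⟩
  1ℚ * 1ℚ * (a + 1ℚ) + ℕ→ℚ 2 * (a * a) * 1ℚ
    ≤⟨ ≤-by (a - 1ℚ) (p≤q⇒0≤q-p 1≤a) (slack a) ⟩
  ℕ→ℚ 2 * 1ℚ * a * (a + 1ℚ)
    ≡⟨ cong (λ u → ℕ→ℚ 2 * u * a * (a + 1ℚ)) (sym al≡1) ⟩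
  ℕ→ℚ 2 * (a * l) * a * (a + 1ℚ)
    ≡⟨ expand-right a l ⟩
  ℕ→ℚ 2 * l * P ∎)
  where
  open ≤-Reasoning
  a = ℕ→ℚ (suc n)
  l = 1/[1+ n ]
  l′ = 1/[1+ suc n ]
  P = a * a * (a + 1ℚ)
  0<a : 0ℚ < a
  0<a = ℕ→ℚ-pos {suc n} (s≤s z≤n)
  0<P : 0ℚ < P
  0<P = *-pos (*-pos 0<a 0<a) (subst (0ℚ <_) (ℕ→ℚ-suc (suc n)) (ℕ→ℚ-pos {suc (suc n)} (s≤s z≤n)))
  1≤a : 1ℚ ≤ a
  1≤a = ℕ→ℚ-mono-≤ {1} {suc n} (s≤s z≤n)
  al≡1 : a * l ≡ 1ℚ
  al≡1 = [1+n]*1/[1+n]≡1 n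
  a′l′≡1 : (a + 1ℚ) * l′ ≡ 1ℚ
  a′l′≡1 = trans (cong (_* l′) (sym (ℕ→ℚ-suc (suc n)))) ([1+n]*1/[1+n]≡1 (suc n))
  expand-left : ∀ a l l′ → (l * l + ℕ→ℚ 2 * l′) * (a * a * (a + 1ℚ))
                           ≡ (a * l) * (a * l) * (a + 1ℚ) + ℕ→ℚ 2 * (a * a) * ((a + 1ℚ) * l′)
  expand-left = solve-∀ ℚ-ring
  slack : ∀ a → 1ℚ * 1ℚ * (a + 1ℚ) + ℕ→ℚ 2 * (a * a) * 1ℚ + (a - 1ℚ) ≡ ℕ→ℚ 2 * 1ℚ * a * (a + 1ℚ)
  slack = solve-∀ ℚ-ring
  expand-right : ∀ a l → ℕ→ℚ 2 * (a * l) * a * (a + 1ℚ) ≡ ℕ→ℚ 2 * l * (a * a * (a + 1ℚ))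
  expand-right = solve-∀ ℚ-ring

∑1/[1+j]²≤2 : ∀ n → ∑[ j < n ] (1/[1+ j ] * 1/[1+ j ]) ≤ ℕ→ℚ 2
∑1/[1+j]²≤2 n = ≤-trans (subst (_≤ S n + 2/[1+ n ]) (+-identityʳ (S n)) (+-monoʳ-≤ (S n) 0≤2/[1+n])) (telescope n)
  where
  open ≤-Reasoning
  S : ℕ → ℚ
  S n = ∑[ j < n ] (1/[1+ j ] * 1/[1+ j ])
  2/[1+_] : ℕ → ℚ
  2/[1+ n ] = ℕ→ℚ 2 * 1/[1+ n ]
  0≤2/[1+n] : 0ℚ ≤ 2/[1+ n ]
  0≤2/[1+n] = *-nonNeg (ℕ→ℚ-nonNeg 2) (<⇒≤ (1/[1+n]-pos n))
  telescope : ∀ n → S n + 2/[1+ n ] ≤ ℕ→ℚ 2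
  telescope zero    = ≤-reflexive (+-identityˡ (ℕ→ℚ 2 * 1ℚ))
  telescope (suc n) = begin
    S (suc n) + 2/[1+ suc n ]                      ≡⟨ cong (_+ 2/[1+ suc n ]) (∑-snoc n (λ j → 1/[1+ j ] * 1/[1+ j ])) ⟩
    S n + 1/[1+ n ] * 1/[1+ n ] + 2/[1+ suc n ]    ≡⟨ +-assoc (S n) _ _ ⟩
    S n + (1/[1+ n ] * 1/[1+ n ] + 2/[1+ suc n ])  ≤⟨ +-monoʳ-≤ (S n) (1/[1+n]²+2/[2+n]≤2/[1+n] n) ⟩
    S n + 2/[1+ n ]                                ≤⟨ telescope n ⟩
    ℕ→ℚ 2                                          ∎

-- Polynomial functions

Polynomial : ℕ → (ℚ → ℚ) → Set
Polynomial n f = Σ[ cs ∈ Vec ℚ (suc n) ] (∀ x → f x ≡ evalPoly cs x)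

poly-evalPoly : ∀ {n} (cs : Vec ℚ (suc n)) → Polynomial n (evalPoly cs)
poly-evalPoly cs = cs , λ _ → refl

evalPoly-const : ∀ c x → evalPoly (c ∷ []) x ≡ c
evalPoly-const c x = trans (cong (c +_) (*-zeroʳ x)) (+-identityʳ c)

poly-cong : ∀ {n f g} → (∀ x → f x ≡ g x) → Polynomial n f → Polynomial n g
poly-cong f≡g (cs , f≡cs) = cs , λ x → trans (sym (f≡g x)) (f≡cs x)

poly-raise : ∀ {m n f} → m ≤ℕ n → Polynomial m f → Polynomial n f
poly-raise m≤n (cs , f≡cs) = pad (s≤s m≤n) cs , λ x → trans (f≡cs x) (sym (evalPoly-pad (s≤s m≤n) cs x))
  where
  pad : ∀ {k l} → k ≤ℕ l → Vec ℚ k → Vec ℚ l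
  pad {l = l} z≤n       []       = replicate l 0ℚ
  pad         (s≤s k≤l) (c ∷ cs) = c ∷ pad k≤l cs
  evalPoly-zeros : ∀ l x → evalPoly (replicate l 0ℚ) x ≡ 0ℚ
  evalPoly-zeros zero    x = refl
  evalPoly-zeros (suc l) x = trans (+-identityˡ _) (trans (cong (x *_) (evalPoly-zeros l x)) (*-zeroʳ x))
  evalPoly-pad : ∀ {k l} (k≤l : k ≤ℕ l) cs x → evalPoly (pad k≤l cs) x ≡ evalPoly cs x
  evalPoly-pad {l = l} z≤n       []       x = evalPoly-zeros l x
  evalPoly-pad         (s≤s k≤l) (c ∷ cs) x = cong (λ p → c + x * p) (evalPoly-pad k≤l cs x)

poly-const : ∀ c → Polynomial 0 (λ _ → c)
poly-const c = (c ∷ []) , λ x → sym (evalPoly-const c x)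

poly-id : Polynomial 1 (λ x → x)
poly-id = (0ℚ ∷ 1ℚ ∷ []) , horner
  where
  horner : ∀ x → x ≡ 0ℚ + x * (1ℚ + x * 0ℚ)
  horner = solve-∀ ℚ-ring

poly-+ : ∀ {n f g} → Polynomial n f → Polynomial n g → Polynomial n (λ x → f x + g x)
poly-+ (as , f≡) (bs , g≡) = zipWith _+_ as bs , λ x → trans (cong₂ _+_ (f≡ x) (g≡ x)) (sym (evalPoly-zipWith as bs x))
  where
  evalPoly-zipWith : ∀ {k} (as bs : Vec ℚ k) x → evalPoly (zipWith _+_ as bs) x ≡ evalPoly as x + evalPoly bs x
  evalPoly-zipWith []       []       x = sym (+-identityˡ 0ℚ)
  evalPoly-zipWith (a ∷ as) (b ∷ bs) x =
    trans (cong (λ p → a + b + x * p) (evalPoly-zipWith as bs x)) (rearrange a b x _ _)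
    where
    rearrange : ∀ a b x p q → a + b + x * (p + q) ≡ (a + x * p) + (b + x * q)
    rearrange = solve-∀ ℚ-ring

poly-scale : ∀ {n f} a → Polynomial n f → Polynomial n (λ x → a * f x)
poly-scale a (cs , f≡) = map (a *_) cs , λ x → trans (cong (a *_) (f≡ x)) (sym (evalPoly-map cs x))
  where
  evalPoly-map : ∀ {k} (cs : Vec ℚ k) x → evalPoly (map (a *_) cs) x ≡ a * evalPoly cs x
  evalPoly-map []       x = sym (*-zeroʳ a)
  evalPoly-map (c ∷ cs) x = trans (cong (λ p → a * c + x * p) (evalPoly-map cs x)) (rearrange a c x _)
    where
    rearrange : ∀ a c x p → a * c + x * (a * p) ≡ a * (c + x * p)
    rearrange = solve-∀ ℚ-ring

poly-- : ∀ {n f g} → Polynomial n f → Polynomial n g → Polynomial n (λ x → f x - g x)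
poly-- {f = f} {g} pf pg = poly-cong (λ x → cong (f x +_) (sym (neg-*ˡ (g x)))) (poly-+ pf (poly-scale (- 1ℚ) pg))
  where
  neg-*ˡ : ∀ p → - p ≡ - 1ℚ * p
  neg-*ˡ = solve-∀ ℚ-ring

poly-x* : ∀ {n f} → Polynomial n f → Polynomial (suc n) (λ x → x * f x)
poly-x* (cs , f≡) = (0ℚ ∷ cs) , λ x → trans (cong (x *_) (f≡ x)) (sym (+-identityˡ _))

poly-* : ∀ {m n f g} → Polynomial m f → Polynomial n g → Polynomial (m ℕ.+ n) (λ x → f x * g x)
poly-* {zero}  {f = f} {g} (c ∷ [] , f≡) pg =
  poly-cong (λ x → cong (_* g x) (sym (trans (f≡ x) (evalPoly-const c x)))) (poly-scale c pg)
poly-* {suc m} {n} {f} {g} (c ∷ cs , f≡) pg =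
  poly-cong (λ x → trans (horner c x _ (g x)) (cong (_* g x) (sym (f≡ x))))
    (poly-+ (poly-raise (ℕ.m≤n+m n (suc m)) (poly-scale c pg)) (poly-x* (poly-* (poly-evalPoly cs) pg)))
  where
  horner : ∀ c x p q → c * q + x * (p * q) ≡ (c + x * p) * q
  horner = solve-∀ ℚ-ring

poly-∘ : ∀ {m n f g} → Polynomial m f → Polynomial n g → Polynomial (m ℕ.* n) (λ x → f (g x))
poly-∘ {zero}  {f = f} {g} (c ∷ [] , f≡) pg =
  poly-cong (λ x → sym (trans (f≡ (g x)) (evalPoly-const c (g x)))) (poly-const c)
poly-∘ {suc m} {f = f} {g} (c ∷ cs , f≡) pg =
  poly-cong (λ x → sym (f≡ (g x))) (poly-+ (poly-raise z≤n (poly-const c)) (poly-* pg (poly-∘ (poly-evalPoly cs) pg)))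

poly-shift : ∀ {n f} → Polynomial n f → Polynomial n (λ x → f (x + 1ℚ))
poly-shift {n} pf =
  subst (λ k → Polynomial k _) (ℕ.*-identityʳ n) (poly-∘ pf (poly-+ poly-id (poly-raise z≤n (poly-const 1ℚ))))

poly-Δ : ∀ {n f} → Polynomial (suc n) f → Polynomial n (λ x → f x - f (x + 1ℚ))
poly-Δ {zero}  {f} (c ∷ b ∷ [] , f≡) =
  poly-cong (λ x → sym (trans (cong₂ _-_ (f≡ x) (f≡ (x + 1ℚ))) (linear c b x))) (poly-const (- b))
  where
  linear : ∀ c b x → (c + x * (b + x * 0ℚ)) - (c + (x + 1ℚ) * (b + (x + 1ℚ) * 0ℚ)) ≡ - b
  linear = solve-∀ ℚ-ring
poly-Δ {suc n} {f} (c ∷ cs , f≡) =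
  poly-cong (λ x → sym (trans (cong₂ _-_ (f≡ x) (f≡ (x + 1ℚ))) (horner c x _ _)))
    (poly-- (poly-x* (poly-Δ (poly-evalPoly cs))) (poly-shift (poly-evalPoly cs)))
  where
  horner : ∀ c x p q → (c + x * p) - (c + (x + 1ℚ) * q) ≡ x * (p - q) - q
  horner = solve-∀ ℚ-ring

poly-factor : ∀ {n f} → Polynomial (suc n) f → ∀ a →
              Σ[ q ∈ (ℚ → ℚ) ] Polynomial n q × (∀ x → f x - f a ≡ (x - a) * q x)
poly-factor {zero}  {f} (c ∷ b ∷ [] , f≡) a =
  (λ _ → b) , poly-const b , λ x → trans (cong₂ _-_ (f≡ x) (f≡ a)) (linear c b x a)
  where
  linear : ∀ c b x a → (c + x * (b + x * 0ℚ)) - (c + a * (b + a * 0ℚ)) ≡ (x - a) * b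
  linear = solve-∀ ℚ-ring
poly-factor {suc n} {f} (c ∷ cs , f≡) a with poly-factor (poly-evalPoly cs) a
... | r , pr , p-p≡ = (λ x → p x + a * r x) , poly-+ (poly-evalPoly cs) (poly-raise (ℕ.n≤1+n n) (poly-scale a pr)) , factor
  where
  open ≡-Reasoning
  p : ℚ → ℚ
  p = evalPoly cs
  horner : ∀ c x a p q → (c + x * p) - (c + a * q) ≡ (x - a) * p + a * (p - q)
  horner = solve-∀ ℚ-ring
  collect : ∀ x a p r → (x - a) * p + a * ((x - a) * r) ≡ (x - a) * (p + a * r)
  collect = solve-∀ ℚ-ring
  factor : ∀ x → f x - f a ≡ (x - a) * (p x + a * r x)
  factor x = begin
    f x - f a                           ≡⟨ cong₂ _-_ (f≡ x) (f≡ a) ⟩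
    (c + x * p x) - (c + a * p a)       ≡⟨ horner c x a (p x) (p a) ⟩
    (x - a) * p x + a * (p x - p a)     ≡⟨ cong (λ d → (x - a) * p x + a * d) (p-p≡ x) ⟩
    (x - a) * p x + a * ((x - a) * r x) ≡⟨ collect x a (p x) (r x) ⟩
    (x - a) * (p x + a * r x)           ∎

-- Binomial coefficients and finite differences

nCk>0 : ∀ {n k} → k ≤ℕ n → 0 ℕ.< n C k
nCk>0 {n}     {zero}  _         = s≤s z≤n
nCk>0 {suc n} {suc k} (s≤s k≤n) =
  subst (0 ℕ.<_) (nCk+nC[k+1]≡[n+1]C[k+1] n k) (ℕ.<-≤-trans (nCk>0 k≤n) (ℕ.m≤m+n _ _))

[k+1]nC[k+1]+knCk≡nnCk : ∀ n k → suc k ℕ.* (n C suc k) ℕ.+ k ℕ.* (n C k) ≡ n ℕ.* (n C k)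
[k+1]nC[k+1]+knCk≡nnCk n       zero    =
  trans (ℕ.+-identityʳ _) (trans (ℕ.*-identityˡ _) (trans (nC1≡n n) (sym (ℕ.*-identityʳ n))))
[k+1]nC[k+1]+knCk≡nnCk zero    (suc k) = cong₂ ℕ._+_ (ℕ.*-zeroʳ (suc (suc k))) (ℕ.*-zeroʳ (suc k))
[k+1]nC[k+1]+knCk≡nnCk (suc n) (suc k) = begin
  suc (suc k) ℕ.* (suc n C suc (suc k)) ℕ.+ suc k ℕ.* (suc n C suc k)
    ≡⟨ cong₂ (λ x y → suc (suc k) ℕ.* x ℕ.+ suc k ℕ.* y) (pascal n (suc k)) (pascal n k) ⟩
  suc (suc k) ℕ.* (b ℕ.+ c) ℕ.+ suc k ℕ.* (a ℕ.+ b)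
    ≡⟨ regroup k a b c ⟩
  (suc (suc k) ℕ.* c ℕ.+ suc k ℕ.* b) ℕ.+ b ℕ.+ (suc k ℕ.* b ℕ.+ k ℕ.* a) ℕ.+ a
    ≡⟨ cong₂ (λ x y → x ℕ.+ b ℕ.+ y ℕ.+ a) ([k+1]nC[k+1]+knCk≡nnCk n (suc k)) ([k+1]nC[k+1]+knCk≡nnCk n k) ⟩
  n ℕ.* b ℕ.+ b ℕ.+ n ℕ.* a ℕ.+ a
    ≡⟨ collect n a b ⟩
  suc n ℕ.* (a ℕ.+ b)
    ≡⟨ cong (suc n ℕ.*_) (sym (pascal n k)) ⟩
  suc n ℕ.* (suc n C suc k) ∎
  where
  open ≡-Reasoning
  a = n C k
  b = n C suc k
  c = n C suc (suc k)
  pascal : ∀ n k → suc n C suc k ≡ n C k ℕ.+ n C suc k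
  pascal n k = sym (nCk+nC[k+1]≡[n+1]C[k+1] n k)
  regroup : ∀ k a b c → suc (suc k) ℕ.* (b ℕ.+ c) ℕ.+ suc k ℕ.* (a ℕ.+ b)
                      ≡ (suc (suc k) ℕ.* c ℕ.+ suc k ℕ.* b) ℕ.+ b ℕ.+ (suc k ℕ.* b ℕ.+ k ℕ.* a) ℕ.+ a
  regroup = ℕ-solve-∀
  collect : ∀ n a b → n ℕ.* b ℕ.+ b ℕ.+ n ℕ.* a ℕ.+ a ≡ suc n ℕ.* (a ℕ.+ b)
  collect = ℕ-solve-∀

nCk≤nC[k+1] : ∀ {n k} → suc (k ℕ.+ k) ≤ℕ n → n C k ≤ℕ n C suc k
nCk≤nC[k+1] {n} {k} 2k+1≤n = ℕ.*-cancelˡ-≤ (suc k) (ℕ.+-cancelʳ-≤ (k ℕ.* (n C k)) _ _ (begin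
  suc k ℕ.* (n C k) ℕ.+ k ℕ.* (n C k)              ≡⟨ sym (ℕ.*-distribʳ-+ (n C k) (suc k) k) ⟩
  suc (k ℕ.+ k) ℕ.* (n C k)                        ≤⟨ ℕ.*-monoˡ-≤ (n C k) 2k+1≤n ⟩
  n ℕ.* (n C k)                                    ≡⟨ sym ([k+1]nC[k+1]+knCk≡nnCk n k) ⟩
  suc k ℕ.* (n C suc k) ℕ.+ k ℕ.* (n C k)          ∎))
  where open ℕ.≤-Reasoning

nC[k+1]≤nCk : ∀ {n k} → n ≤ℕ k ℕ.+ k → n C suc k ≤ℕ n C k
nC[k+1]≤nCk {n} {k} n≤2k = ℕ.*-cancelˡ-≤ (suc k) (ℕ.+-cancelʳ-≤ (k ℕ.* (n C k)) _ _ (begin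
  suc k ℕ.* (n C suc k) ℕ.+ k ℕ.* (n C k)          ≡⟨ [k+1]nC[k+1]+knCk≡nnCk n k ⟩
  n ℕ.* (n C k)                                    ≤⟨ ℕ.*-monoˡ-≤ (n C k) (ℕ.m≤n⇒m≤1+n n≤2k) ⟩
  suc (k ℕ.+ k) ℕ.* (n C k)                        ≡⟨ ℕ.*-distribʳ-+ (n C k) (suc k) k ⟩
  suc k ℕ.* (n C k) ℕ.+ k ℕ.* (n C k)              ∎))
  where open ℕ.≤-Reasoning

unimodal⇒max : ∀ (f : ℕ → ℕ) m →
               (∀ k → suc k ≤ℕ m → f k ≤ℕ f (suc k)) → (∀ k → m ≤ℕ k → f (suc k) ≤ℕ f k) → ∀ k → f k ≤ℕ f m
unimodal⇒max f m up down k with ℕ.≤-total k m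
... | inj₁ k≤m = ascend (m ℕ.∸ k) k (ℕ.m+[n∸m]≡n k≤m)
  where
  ascend : ∀ j k → k ℕ.+ j ≡ m → f k ≤ℕ f m
  ascend zero    k refl = ℕ.≤-reflexive (cong f (sym (ℕ.+-identityʳ k)))
  ascend (suc j) k refl =
    ℕ.≤-trans (up k (subst (suc k ≤ℕ_) (sym (ℕ.+-suc k j)) (ℕ.m≤m+n (suc k) j))) (ascend j (suc k) (sym (ℕ.+-suc k j)))
... | inj₂ m≤k = subst (λ i → f i ≤ℕ f m) (ℕ.m+[n∸m]≡n m≤k) (descend (k ℕ.∸ m))
  where
  descend : ∀ j → f (m ℕ.+ j) ≤ℕ f m
  descend zero    = ℕ.≤-reflexive (cong f (ℕ.+-identityʳ m))
  descend (suc j) =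
    ℕ.≤-trans (subst (λ i → f i ≤ℕ f (m ℕ.+ j)) (sym (ℕ.+-suc m j)) (down (m ℕ.+ j) (ℕ.m≤m+n m j))) (descend j)

[2D]Ck≤[2D]CD : ∀ D k → (D ℕ.+ D) C k ≤ℕ (D ℕ.+ D) C D
[2D]Ck≤[2D]CD D = unimodal⇒max ((D ℕ.+ D) C_) D
  (λ k k<D → nCk≤nC[k+1] {D ℕ.+ D} {k} (ℕ.≤-trans (s≤s (ℕ.+-monoʳ-≤ k (ℕ.<⇒≤ k<D))) (ℕ.+-monoˡ-≤ D k<D)))
  (λ k D≤k → nC[k+1]≤nCk {D ℕ.+ D} {k} (ℕ.+-mono-≤ D≤k D≤k))

-1^_ : ℕ → ℚ
-1^ zero  = 1ℚ
-1^ suc k = - (-1^ k)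

-1^k*-1^k≡1 : ∀ k → -1^ k * -1^ k ≡ 1ℚ
-1^k*-1^k≡1 zero    = refl
-1^k*-1^k≡1 (suc k) = trans (neg-square (-1^ k)) (-1^k*-1^k≡1 k)
  where
  neg-square : ∀ s → - s * - s ≡ s * s
  neg-square = solve-∀ ℚ-ring

∣-1^k∣≡1 : ∀ k → ∣ -1^ k ∣ ≡ 1ℚ
∣-1^k∣≡1 zero    = refl
∣-1^k∣≡1 (suc k) = trans (∣-p∣≡∣p∣ (-1^ k)) (∣-1^k∣≡1 k)

-- (−1)ⁿ times the n-th forward difference of f at 0.
finiteDifference : ℕ → (ℕ → ℚ) → ℚ
finiteDifference n f = ∑[ k < suc n ] (-1^ k * ℕ→ℚ (n C k) * f k)

finiteDifference-cong : ∀ n {f g : ℕ → ℚ} → (∀ k → f k ≡ g k) →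
                        finiteDifference n f ≡ finiteDifference n g
finiteDifference-cong n {f} {g} f≡g = ∑-cong (suc n) (λ k _ → cong (-1^ k * ℕ→ℚ (n C k) *_) (f≡g k))

finiteDifference-suc : ∀ n f → finiteDifference (suc n) f ≡ finiteDifference n (λ k → f k - f (suc k))
finiteDifference-suc n f = begin
  b n 0 * f 0 + ∑[ k < suc n ] (b (suc n) (suc k) * f (suc k))
    ≡⟨ cong (b n 0 * f 0 +_) (∑-cong (suc n) (λ k _ → pascal k)) ⟩
  b n 0 * f 0 + ∑[ k < suc n ] (b n (suc k) * f (suc k) - b n k * f (suc k))
    ≡⟨ cong (b n 0 * f 0 +_) (∑-- (suc n) (λ k → b n (suc k) * f (suc k)) (λ k → b n k * f (suc k))) ⟩
  b n 0 * f 0 + (∑[ k < suc n ] (b n (suc k) * f (suc k)) - ∑[ k < suc n ] (b n k * f (suc k)))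
    ≡⟨ sym (+-assoc (b n 0 * f 0) _ _) ⟩
  ∑[ k < suc (suc n) ] (b n k * f k) - ∑[ k < suc n ] (b n k * f (suc k))
    ≡⟨ cong (_- ∑[ k < suc n ] (b n k * f (suc k))) (trans (∑-snoc (suc n) (λ k → b n k * f k)) last-vanishes) ⟩
  ∑[ k < suc n ] (b n k * f k) - ∑[ k < suc n ] (b n k * f (suc k))
    ≡⟨ sym (∑-- (suc n) (λ k → b n k * f k) (λ k → b n k * f (suc k))) ⟩
  ∑[ k < suc n ] (b n k * f k - b n k * f (suc k))
    ≡⟨ ∑-cong (suc n) (λ k _ → sym (*-distribˡ-- (b n k) (f k) (f (suc k)))) ⟩
  finiteDifference n (λ k → f k - f (suc k)) ∎
  where
  open ≡-Reasoning
  b : ℕ → ℕ → ℚ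
  b n k = -1^ k * ℕ→ℚ (n C k)
  *-distribˡ-- : ∀ a x y → a * (x - y) ≡ a * x - a * y
  *-distribˡ-- = solve-∀ ℚ-ring
  pascal : ∀ k → b (suc n) (suc k) * f (suc k) ≡ b n (suc k) * f (suc k) - b n k * f (suc k)
  pascal k = begin
    - (-1^ k) * ℕ→ℚ (suc n C suc k) * f (suc k)
      ≡⟨ cong (λ c → - (-1^ k) * c * f (suc k)) (trans (cong ℕ→ℚ (sym (nCk+nC[k+1]≡[n+1]C[k+1] n k)))
                                                       (ℕ→ℚ-+ (n C k) (n C suc k))) ⟩
    - (-1^ k) * (ℕ→ℚ (n C k) + ℕ→ℚ (n C suc k)) * f (suc k)
      ≡⟨ distribute (-1^ k) _ _ (f (suc k)) ⟩
    - (-1^ k) * ℕ→ℚ (n C suc k) * f (suc k) - -1^ k * ℕ→ℚ (n C k) * f (suc k) ∎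
    where
    distribute : ∀ s c c′ y → - s * (c + c′) * y ≡ - s * c′ * y - s * c * y
    distribute = solve-∀ ℚ-ring
  S : ℚ
  S = ∑[ k < suc n ] (b n k * f k)
  last-vanishes : S + b n (suc n) * f (suc n) ≡ S
  last-vanishes = trans (cong (λ c → S + -1^ suc n * ℕ→ℚ c * f (suc n)) (k>n⇒nCk≡0 (ℕ.n<1+n n)))
                        (zero-term S (-1^ suc n) (f (suc n)))
    where
    zero-term : ∀ s a y → s + a * 0ℚ * y ≡ s
    zero-term = solve-∀ ℚ-ring

finiteDifference-polynomial : ∀ {m n p} → Polynomial m p → m ℕ.< n → finiteDifference n (λ k → p (ℕ→ℚ k)) ≡ 0ℚ
finiteDifference-polynomial {m} {suc n} {p} pp (s≤s m≤n) = begin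
  finiteDifference (suc n) (λ k → p (ℕ→ℚ k))
    ≡⟨ finiteDifference-suc n (λ k → p (ℕ→ℚ k)) ⟩
  finiteDifference n (λ k → p (ℕ→ℚ k) - p (ℕ→ℚ (suc k)))
    ≡⟨ finiteDifference-cong n (λ k → cong (λ x → p (ℕ→ℚ k) - p x) (ℕ→ℚ-suc k)) ⟩
  finiteDifference n (λ k → Δp (ℕ→ℚ k))
    ≡⟨ Δ-vanishes m pp m≤n ⟩
  0ℚ ∎
  where
  open ≡-Reasoning
  Δp : ℚ → ℚ
  Δp x = p x - p (x + 1ℚ)
  Δ-vanishes : ∀ m → Polynomial m p → m ≤ℕ n → finiteDifference n (λ k → Δp (ℕ→ℚ k)) ≡ 0ℚ
  Δ-vanishes zero    (c ∷ [] , p≡) _   =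
    trans (finiteDifference-cong n (λ k → constant (ℕ→ℚ k))) (∑-*-zeroʳ (suc n) {λ k → -1^ k * ℕ→ℚ (n C k)})
    where
    constant : ∀ x → Δp x ≡ 0ℚ
    constant x = trans (cong₂ _-_ (trans (p≡ x) (evalPoly-const c x)) (trans (p≡ (x + 1ℚ)) (evalPoly-const c (x + 1ℚ))))
                       (+-inverseʳ c)
  Δ-vanishes (suc m) pp        m<n = finiteDifference-polynomial (poly-Δ pp) m<n

-- The dual polynomial

module DualPolynomial (e D : ℕ) (1≤e : 1 ≤ℕ e) where

  N : ℕ
  N = suc (D ℕ.+ D)

  offset : ℕ → ℕ
  offset k = ℕ.∣ k - D ∣

  node-1 : ℕ → ℕ
  node-1 k = suc e ℕ.* (offset k ℕ.* offset k)

  node : ℕ → ℕ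
  node k = suc (node-1 k)

  offset≤D : ∀ k → k ℕ.< N → offset k ≤ℕ D
  offset≤D k (s≤s k≤2D) with ℕ.≤-total k D
  ... | inj₁ k≤D = ℕ.≤-trans (ℕ.≤-reflexive (ℕ.m≤n⇒∣m-n∣≡n∸m k≤D)) (ℕ.m∸n≤m D k)
  ... | inj₂ D≤k = ℕ.≤-trans (ℕ.≤-reflexive (ℕ.m≤n⇒∣n-m∣≡n∸m D≤k)) (ℕ.m≤n+o⇒m∸n≤o k D k≤2D)

  node≤ : ∀ k → k ℕ.< N → node k ≤ℕ suc (suc e ℕ.* (D ℕ.* D))
  node≤ k k<N = s≤s (ℕ.*-monoʳ-≤ (suc e) (ℕ.*-mono-≤ (offset≤D k k<N) (offset≤D k k<N)))

  node-D : node D ≡ 1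
  node-D = trans (cong (λ m → suc (suc e ℕ.* (m ℕ.* m))) (ℕ.∣n-n∣≡0 D)) (cong suc (ℕ.*-zeroʳ (suc e)))

  node≢2 : ∀ k → node k ≢ 2
  node≢2 k eq = ℕ.<⇒≢ (s≤s 1≤e) (sym (ℕ.m*n≡1⇒m≡1 (suc e) _ (ℕ.suc-injective eq)))

  node≡1⇒k≡D : ∀ k → node k ≡ 1 → k ≡ D
  node≡1⇒k≡D k eq with ℕ.m*n≡0⇒m≡0∨n≡0 (suc e) (ℕ.suc-injective eq)
  ... | inj₂ m²≡0 with ℕ.m*n≡0⇒m≡0∨n≡0 (offset k) m²≡0
  ...   | inj₁ m≡0 = ℕ.∣m-n∣≡0⇒m≡n m≡0
  ...   | inj₂ m≡0 = ℕ.∣m-n∣≡0⇒m≡n m≡0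

  nodePoly : ℚ → ℚ
  nodePoly x = ℕ→ℚ (suc e) * ((x - ℕ→ℚ D) * (x - ℕ→ℚ D)) + 1ℚ

  node≡nodePoly : ∀ k → ℕ→ℚ (node k) ≡ nodePoly (ℕ→ℚ k)
  node≡nodePoly k = trans (ℕ→ℚ-1+c*n² (suc e) (offset k)) (cong (λ s → ℕ→ℚ (suc e) * s + 1ℚ) (ℕ→ℚ-∣m-n∣² k D))

  nodePoly-polynomial : Polynomial 2 nodePoly
  nodePoly-polynomial = poly-+ (poly-scale (ℕ→ℚ (suc e)) (poly-* x-D x-D)) (poly-raise z≤n (poly-const 1ℚ))
    where
    x-D : Polynomial 1 (λ x → x - ℕ→ℚ D)
    x-D = poly-- poly-id (poly-raise z≤n (poly-const (ℕ→ℚ D)))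

  denom : ℕ → ℚ
  denom k = ℕ→ℚ (node k) - ℕ→ℚ 2

  denom≢0 : ∀ k → denom k ≢ 0ℚ
  denom≢0 k eq = node≢2 k (ℕ→ℚ-injective (x∙y⁻¹≈ε⇒x≈y (ℕ→ℚ (node k)) (ℕ→ℚ 2) eq))
    where open import Algebra.Properties.Group +-0-group using (x∙y⁻¹≈ε⇒x≈y)

  e*offset²≤denom : ∀ k j → offset k ≡ suc j → ℕ→ℚ e * (ℕ→ℚ (suc j) * ℕ→ℚ (suc j)) ≤ denom k
  e*offset²≤denom k j offset≡ = subst (_≤ denom k) (cancel E (ℕ→ℚ 2)) (+-monoˡ-≤ (- ℕ→ℚ 2) E+2≤node)
    where
    E = ℕ→ℚ e * (ℕ→ℚ (suc j) * ℕ→ℚ (suc j))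
    cancel : ∀ x t → x + t - t ≡ x
    cancel = solve-∀ ℚ-ring
    es²+2≤node : e ℕ.* (suc j ℕ.* suc j) ℕ.+ 2 ≤ℕ node k
    es²+2≤node = subst (λ m → e ℕ.* (suc j ℕ.* suc j) ℕ.+ 2 ≤ℕ suc (suc e ℕ.* (m ℕ.* m))) (sym offset≡)
                       (ℕ.≤-trans (ℕ.≤-reflexive (ℕ.+-comm (e ℕ.* (suc j ℕ.* suc j)) 2))
                                  (s≤s (s≤s (ℕ.m≤n+m (e ℕ.* (suc j ℕ.* suc j)) (j ℕ.+ j ℕ.* suc j)))))
    E+2≤node : E + ℕ→ℚ 2 ≤ ℕ→ℚ (node k)
    E+2≤node = subst (_≤ ℕ→ℚ (node k))
                     (trans (ℕ→ℚ-+ (e ℕ.* (suc j ℕ.* suc j)) 2)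
                            (cong (_+ ℕ→ℚ 2) (trans (ℕ→ℚ-* e (suc j ℕ.* suc j)) (cong (ℕ→ℚ e *_) (ℕ→ℚ-* (suc j) (suc j))))))
                     (ℕ→ℚ-mono-≤ es²+2≤node)

  weight : ℕ → ℚ
  weight k = -1^ D * -1^ k * ℕ→ℚ ((D ℕ.+ D) C k) * (1/ denom k) {{≢-nonZero (denom≢0 k)}}

  weight*denom : ∀ k → weight k * denom k ≡ -1^ D * (-1^ k * ℕ→ℚ ((D ℕ.+ D) C k))
  weight*denom k = begin
    s * c * 1/d * denom k       ≡⟨ *-assoc (s * c) 1/d (denom k) ⟩
    s * c * (1/d * denom k)     ≡⟨ cong (s * c *_) (*-inverseˡ (denom k) {{≢-nonZero (denom≢0 k)}}) ⟩
    s * c * 1ℚ                  ≡⟨ *-identityʳ (s * c) ⟩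
    s * c                       ≡⟨ *-assoc (-1^ D) (-1^ k) c ⟩
    -1^ D * (-1^ k * c)         ∎
    where
    open ≡-Reasoning
    s = -1^ D * -1^ k
    c = ℕ→ℚ ((D ℕ.+ D) C k)
    1/d = (1/ denom k) {{≢-nonZero (denom≢0 k)}}

  ω : ℕ → ℚ
  ω x = ∑[ k < N ] (weight k * (𝟙[ x ≡ 2 ] - 𝟙[ x ≡ node k ]))

  ω-integrate : ∀ L (f : ℕ → ℚ) → 2 ≤ℕ L → (∀ k → k ℕ.< N → node k ≤ℕ L) →
                sum1to L (λ x → f x * ω x) ≡ ∑[ k < N ] (weight k * (f 2 - f (node k)))
  ω-integrate L f 2≤L nodes≤L = begin
    sum1to L (λ x → f x * ω x)
      ≡⟨ sum1to≡∑ L (λ x → f x * ω x) ⟩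
    ∑[ x < L ] (f (suc x) * ω (suc x))
      ≡⟨ ∑-cong L (λ x _ → expand x) ⟩
    ∑[ x < L ] (∑[ k < N ] (F k x * 𝟙[ x ≡ 1 ]) - ∑[ k < N ] (F k x * 𝟙[ x ≡ node-1 k ]))
      ≡⟨ ∑-- L (λ x → ∑[ k < N ] (F k x * 𝟙[ x ≡ 1 ])) (λ x → ∑[ k < N ] (F k x * 𝟙[ x ≡ node-1 k ])) ⟩
    ∑[ x < L ] ∑[ k < N ] (F k x * 𝟙[ x ≡ 1 ]) - ∑[ x < L ] ∑[ k < N ] (F k x * 𝟙[ x ≡ node-1 k ])
      ≡⟨ cong₂ _-_ (∑∑𝟙 L N F (λ _ → 1) (λ _ _ → 2≤L)) (∑∑𝟙 L N F node-1 nodes≤L) ⟩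
    ∑[ k < N ] F k 1 - ∑[ k < N ] F k (node-1 k)
      ≡⟨ sym (∑-- N (λ k → F k 1) (λ k → F k (node-1 k))) ⟩
    ∑[ k < N ] (weight k * f 2 - weight k * f (node k))
      ≡⟨ ∑-cong N (λ k _ → sym (*-distribˡ-- (weight k) (f 2) (f (node k)))) ⟩
    ∑[ k < N ] (weight k * (f 2 - f (node k))) ∎
    where
    open ≡-Reasoning
    F : ℕ → ℕ → ℚ
    F k x = weight k * f (suc x)
    *-distribˡ-- : ∀ a x y → a * (x - y) ≡ a * x - a * y
    *-distribˡ-- = solve-∀ ℚ-ring
    expand : ∀ x → f (suc x) * ω (suc x) ≡ ∑[ k < N ] (F k x * 𝟙[ x ≡ 1 ]) - ∑[ k < N ] (F k x * 𝟙[ x ≡ node-1 k ])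
    expand x = begin
      f (suc x) * ω (suc x)
        ≡⟨ sym (∑-*ˡ N (f (suc x)) (λ k → weight k * (𝟙[ x ≡ 1 ] - 𝟙[ x ≡ node-1 k ]))) ⟩
      ∑[ k < N ] (f (suc x) * (weight k * (𝟙[ x ≡ 1 ] - 𝟙[ x ≡ node-1 k ])))
        ≡⟨ ∑-cong N (λ k _ → distribute (f (suc x)) (weight k) 𝟙[ x ≡ 1 ] 𝟙[ x ≡ node-1 k ]) ⟩
      ∑[ k < N ] (F k x * 𝟙[ x ≡ 1 ] - F k x * 𝟙[ x ≡ node-1 k ])
        ≡⟨ ∑-- N (λ k → F k x * 𝟙[ x ≡ 1 ]) (λ k → F k x * 𝟙[ x ≡ node-1 k ]) ⟩
      ∑[ k < N ] (F k x * 𝟙[ x ≡ 1 ]) - ∑[ k < N ] (F k x * 𝟙[ x ≡ node-1 k ]) ∎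
      where
      distribute : ∀ p w a b → p * (w * (a - b)) ≡ w * p * a - w * p * b
      distribute = solve-∀ ℚ-ring

  weights-orthogonal : ∀ {d p} → Polynomial d p → d ≤ℕ D →
                       ∑[ k < N ] (weight k * (p (ℕ→ℚ 2) - p (ℕ→ℚ (node k)))) ≡ 0ℚ
  weights-orthogonal {zero} {p} (c ∷ [] , p≡) _ =
    trans (∑-cong N (λ k _ → trans (cong (weight k *_) (constant (ℕ→ℚ 2) (ℕ→ℚ (node k)))) (*-zeroʳ (weight k)))) (∑-zero N)
    where
    constant : ∀ a b → p a - p b ≡ 0ℚ
    constant a b = trans (cong₂ _-_ (trans (p≡ a) (evalPoly-const c a)) (trans (p≡ b) (evalPoly-const c b))) (+-inverseʳ c)
  weights-orthogonal {suc d} {p} pp d<D = factored (poly-factor pp (ℕ→ℚ 2))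
    where
    factored : Σ[ q ∈ (ℚ → ℚ) ] Polynomial d q × (∀ x → p x - p (ℕ→ℚ 2) ≡ (x - ℕ→ℚ 2) * q x) →
               ∑[ k < N ] (weight k * (p (ℕ→ℚ 2) - p (ℕ→ℚ (node k)))) ≡ 0ℚ
    factored (q , pq , factor) = begin
      ∑[ k < N ] (weight k * (p (ℕ→ℚ 2) - p (ℕ→ℚ (node k))))
        ≡⟨ ∑-cong N (λ k _ → term k) ⟩
      ∑[ k < N ] (- (-1^ D * (-1^ k * ℕ→ℚ ((D ℕ.+ D) C k) * q (nodePoly (ℕ→ℚ k)))))
        ≡⟨ ∑-neg N (λ k → -1^ D * (-1^ k * ℕ→ℚ ((D ℕ.+ D) C k) * q (nodePoly (ℕ→ℚ k)))) ⟩
      - ∑[ k < N ] (-1^ D * (-1^ k * ℕ→ℚ ((D ℕ.+ D) C k) * q (nodePoly (ℕ→ℚ k))))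
        ≡⟨ cong -_ (∑-*ˡ N (-1^ D) (λ k → -1^ k * ℕ→ℚ ((D ℕ.+ D) C k) * q (nodePoly (ℕ→ℚ k)))) ⟩
      - (-1^ D * finiteDifference (D ℕ.+ D) (λ k → q (nodePoly (ℕ→ℚ k))))
        ≡⟨ cong (λ z → - (-1^ D * z)) (finiteDifference-polynomial {p = λ x → q (nodePoly x)} (poly-∘ pq nodePoly-polynomial) 2d<2D) ⟩
      - (-1^ D * 0ℚ)
        ≡⟨ cong -_ (*-zeroʳ (-1^ D)) ⟩
      0ℚ ∎
      where
      open ≡-Reasoning
      2d<2D : d ℕ.* 2 ℕ.< D ℕ.+ D
      2d<2D = subst (ℕ._< D ℕ.+ D) (double d) (ℕ.+-mono-< d<D d<D)
        where
        double : ∀ d → d ℕ.+ d ≡ d ℕ.* 2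
        double = ℕ-solve-∀
      flip : ∀ w a b → w * (a - b) ≡ - (w * (b - a))
      flip = solve-∀ ℚ-ring
      term : ∀ k → weight k * (p (ℕ→ℚ 2) - p (ℕ→ℚ (node k))) ≡ - (-1^ D * (-1^ k * ℕ→ℚ ((D ℕ.+ D) C k) * q (nodePoly (ℕ→ℚ k))))
      term k = begin
        weight k * (p (ℕ→ℚ 2) - p x)                ≡⟨ flip (weight k) (p (ℕ→ℚ 2)) (p x) ⟩
        - (weight k * (p x - p (ℕ→ℚ 2)))            ≡⟨ cong (λ z → - (weight k * z)) (factor x) ⟩
        - (weight k * (denom k * q x))              ≡⟨ cong -_ (sym (*-assoc (weight k) (denom k) (q x))) ⟩
        - (weight k * denom k * q x)                ≡⟨ cong (λ z → - (z * q x)) (weight*denom k) ⟩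
        - (-1^ D * (-1^ k * c) * q x)               ≡⟨ cong -_ (*-assoc (-1^ D) (-1^ k * c) (q x)) ⟩
        - (-1^ D * (-1^ k * c * q x))               ≡⟨ cong (λ z → - (-1^ D * (-1^ k * c * q z))) (node≡nodePoly k) ⟩
        - (-1^ D * (-1^ k * c * q (nodePoly (ℕ→ℚ k)))) ∎
        where
        x = ℕ→ℚ (node k)
        c = ℕ→ℚ ((D ℕ.+ D) C k)

  ω-orthogonal : ∀ L → 2 ≤ℕ L → (∀ k → k ℕ.< N → node k ≤ℕ L) → ∀ {d} → d ≤ℕ D → (cs : Vec ℚ (suc d)) →
                 sum1to L (λ x → evalPoly cs (ℕ→ℚ x) * ω x) ≡ 0ℚ
  ω-orthogonal L 2≤L nodes≤L d≤D cs =
    trans (ω-integrate L (λ x → evalPoly cs (ℕ→ℚ x)) 2≤L nodes≤L) (weights-orthogonal {p = evalPoly cs} (poly-evalPoly cs) d≤D)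

  u : ℚ
  u = ℕ→ℚ ((D ℕ.+ D) C D)

  weight-D : weight D ≡ - u
  weight-D = begin
    weight D                        ≡⟨ sym (neg-involutive (weight D)) ⟩
    - - weight D                    ≡⟨ cong -_ (sym (*-neg-1 (weight D))) ⟩
    - (weight D * - 1ℚ)             ≡⟨ cong (λ z → - (weight D * z)) (sym denom-D) ⟩
    - (weight D * denom D)          ≡⟨ cong -_ (weight*denom D) ⟩
    - (-1^ D * (-1^ D * u))         ≡⟨ cong -_ (trans (sym (*-assoc (-1^ D) (-1^ D) u)) (trans (cong (_* u) (-1^k*-1^k≡1 D)) (*-identityˡ u))) ⟩
    - u                             ∎
    where
    open ≡-Reasoning
    denom-D : denom D ≡ - 1ℚ
    denom-D = cong (λ n → ℕ→ℚ n - ℕ→ℚ 2) node-D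
    neg-involutive : ∀ x → - - x ≡ x
    neg-involutive = solve-∀ ℚ-ring
    *-neg-1 : ∀ x → x * - 1ℚ ≡ - x
    *-neg-1 = solve-∀ ℚ-ring

  ω-at-1 : ω 1 ≡ u
  ω-at-1 = begin
    ∑[ k < N ] (weight k * (0ℚ - 𝟙[ 1 ≡ node k ]))    ≡⟨ ∑-cong N (λ k _ → cong (λ z → weight k * (0ℚ - z)) (𝟙[1≡node] k)) ⟩
    ∑[ k < N ] (weight k * (0ℚ - 𝟙[ k ≡ D ]))         ≡⟨ ∑-cong N (λ k _ → negate (weight k) 𝟙[ k ≡ D ]) ⟩
    ∑[ k < N ] (- (weight k * 𝟙[ k ≡ D ]))            ≡⟨ ∑-neg N (λ k → weight k * 𝟙[ k ≡ D ]) ⟩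
    - ∑[ k < N ] (weight k * 𝟙[ k ≡ D ])              ≡⟨ cong -_ (∑-𝟙 N weight (s≤s (ℕ.m≤m+n D D))) ⟩
    - weight D                                        ≡⟨ cong -_ weight-D ⟩
    - - u                                             ≡⟨ neg-involutive u ⟩
    u                                                 ∎
    where
    open ≡-Reasoning
    negate : ∀ w i → w * (0ℚ - i) ≡ - (w * i)
    negate = solve-∀ ℚ-ring
    neg-involutive : ∀ x → - - x ≡ x
    neg-involutive = solve-∀ ℚ-ring
    𝟙[1≡node] : ∀ k → 𝟙[ 1 ≡ node k ] ≡ 𝟙[ k ≡ D ]
    𝟙[1≡node] k = by-cases (k ℕ.≟ D)
      where
      by-cases : Dec (k ≡ D) → 𝟙[ 1 ≡ node k ] ≡ 𝟙[ k ≡ D ]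
      by-cases (yes refl) = trans (cong (λ n → 𝟙[ 1 ≡ n ]) node-D) (sym (𝟙[x≡x] k))
      by-cases (no  k≢D)  = trans (𝟙[x≢y] (k≢D ∘ node≡1⇒k≡D k ∘ sym)) (sym (𝟙[x≢y] k≢D))

  ω-at-2 : ω 2 ≡ ∑[ k < N ] weight k
  ω-at-2 = ∑-cong N (λ k _ → trans (cong (λ z → weight k * (1ℚ - z)) (𝟙[x≢y] (node≢2 k ∘ sym))) (*-identityʳ (weight k)))

  sum1to-∣ω∣≤ : ∀ L → 2 ≤ℕ L → (∀ k → k ℕ.< N → node k ≤ℕ L) →
             sum1to L (λ x → ∣ ω x ∣) ≤ ∑[ k < N ] ∣ weight k ∣ + ∑[ k < N ] ∣ weight k ∣
  sum1to-∣ω∣≤ L 2≤L nodes≤L = begin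
    sum1to L (λ x → ∣ ω x ∣)
      ≡⟨ sum1to≡∑ L (λ x → ∣ ω x ∣) ⟩
    ∑[ x < L ] ∣ ω (suc x) ∣
      ≤⟨ ∑-mono-≤ L pointwise ⟩
    ∑[ x < L ] (∑[ k < N ] (∣ weight k ∣ * 𝟙[ x ≡ 1 ]) + ∑[ k < N ] (∣ weight k ∣ * 𝟙[ x ≡ node-1 k ]))
      ≡⟨ ∑-+ L (λ x → ∑[ k < N ] (∣ weight k ∣ * 𝟙[ x ≡ 1 ])) (λ x → ∑[ k < N ] (∣ weight k ∣ * 𝟙[ x ≡ node-1 k ])) ⟩
    ∑[ x < L ] ∑[ k < N ] (∣ weight k ∣ * 𝟙[ x ≡ 1 ]) + ∑[ x < L ] ∑[ k < N ] (∣ weight k ∣ * 𝟙[ x ≡ node-1 k ])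
      ≡⟨ cong₂ _+_ (∑∑𝟙 L N (λ k _ → ∣ weight k ∣) (λ _ → 1) (λ _ _ → 2≤L))
                   (∑∑𝟙 L N (λ k _ → ∣ weight k ∣) node-1 nodes≤L) ⟩
    ∑[ k < N ] ∣ weight k ∣ + ∑[ k < N ] ∣ weight k ∣ ∎
    where
    open ≤-Reasoning
    dipole : ∀ w a b → 0ℚ ≤ a → 0ℚ ≤ b → ∣ w * (a - b) ∣ ≤ ∣ w ∣ * a + ∣ w ∣ * b
    dipole w a b 0≤a 0≤b = begin
      ∣ w * (a - b) ∣         ≡⟨ ∣p*q∣≡∣p∣*∣q∣ w (a - b) ⟩
      ∣ w ∣ * ∣ a - b ∣       ≤⟨ *-monoˡ-≤ (0≤∣p∣ w) (∣p-q∣≤∣p∣+∣q∣ a b) ⟩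
      ∣ w ∣ * (∣ a ∣ + ∣ b ∣) ≡⟨ cong₂ (λ s t → ∣ w ∣ * (s + t)) (0≤p⇒∣p∣≡p 0≤a) (0≤p⇒∣p∣≡p 0≤b) ⟩
      ∣ w ∣ * (a + b)         ≡⟨ *-distribˡ-+ ∣ w ∣ a b ⟩
      ∣ w ∣ * a + ∣ w ∣ * b   ∎
    pointwise : ∀ x → ∣ ω (suc x) ∣ ≤ ∑[ k < N ] (∣ weight k ∣ * 𝟙[ x ≡ 1 ]) + ∑[ k < N ] (∣ weight k ∣ * 𝟙[ x ≡ node-1 k ])
    pointwise x = begin
      ∣ ω (suc x) ∣
        ≤⟨ ∣∑∣≤∑∣∣ N (λ k → weight k * (𝟙[ x ≡ 1 ] - 𝟙[ x ≡ node-1 k ])) ⟩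
      ∑[ k < N ] ∣ weight k * (𝟙[ x ≡ 1 ] - 𝟙[ x ≡ node-1 k ]) ∣
        ≤⟨ ∑-mono-≤ N (λ k → dipole (weight k) 𝟙[ x ≡ 1 ] 𝟙[ x ≡ node-1 k ] (𝟙-nonNeg x 1) (𝟙-nonNeg x (node-1 k))) ⟩
      ∑[ k < N ] (∣ weight k ∣ * 𝟙[ x ≡ 1 ] + ∣ weight k ∣ * 𝟙[ x ≡ node-1 k ])
        ≡⟨ ∑-+ N (λ k → ∣ weight k ∣ * 𝟙[ x ≡ 1 ]) (λ k → ∣ weight k ∣ * 𝟙[ x ≡ node-1 k ]) ⟩
      ∑[ k < N ] (∣ weight k ∣ * 𝟙[ x ≡ 1 ]) + ∑[ k < N ] (∣ weight k ∣ * 𝟙[ x ≡ node-1 k ]) ∎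

  u-nonNeg : 0ℚ ≤ u
  u-nonNeg = ℕ→ℚ-nonNeg ((D ℕ.+ D) C D)

  ∣weight-D∣ : ∣ weight D ∣ ≡ u
  ∣weight-D∣ = trans (cong ∣_∣ weight-D) (trans (∣-p∣≡∣p∣ u) (0≤p⇒∣p∣≡p u-nonNeg))

  weightBound : ℕ → ℚ
  weightBound zero    = ℕ→ℚ e * u
  weightBound (suc j) = u * (1/[1+ j ] * 1/[1+ j ])

  ∣weight∣≡ : ∀ k (0<d : 0ℚ < denom k) → ∣ weight k ∣ ≡ ℕ→ℚ ((D ℕ.+ D) C k) * (1/ denom k) {{>-nonZero 0<d}}
  ∣weight∣≡ k 0<d = begin
    ∣ s * c * 1/d ∣       ≡⟨ ∣p*q∣≡∣p∣*∣q∣ (s * c) 1/d ⟩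
    ∣ s * c ∣ * ∣ 1/d ∣   ≡⟨ cong₂ _*_ (∣p*q∣≡∣p∣*∣q∣ s c) (0≤p⇒∣p∣≡p (<⇒≤ (1/-pos 0<d))) ⟩
    ∣ s ∣ * ∣ c ∣ * 1/d   ≡⟨ cong₂ (λ x y → x * y * 1/d) ∣s∣≡1 (0≤p⇒∣p∣≡p (ℕ→ℚ-nonNeg ((D ℕ.+ D) C k))) ⟩
    1ℚ * c * 1/d          ≡⟨ cong (_* 1/d) (*-identityˡ c) ⟩
    c * 1/d               ∎
    where
    open ≡-Reasoning
    s = -1^ D * -1^ k
    c = ℕ→ℚ ((D ℕ.+ D) C k)
    1/d = (1/ denom k) {{>-nonZero 0<d}}
    ∣s∣≡1 : ∣ s ∣ ≡ 1ℚ
    ∣s∣≡1 = trans (∣p*q∣≡∣p∣*∣q∣ (-1^ D) (-1^ k)) (cong₂ _*_ (∣-1^k∣≡1 D) (∣-1^k∣≡1 k))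

  e*∣weight∣≤u/[1+j]² : ∀ k j → offset k ≡ suc j → ℕ→ℚ e * ∣ weight k ∣ ≤ u * (1/[1+ j ] * 1/[1+ j ])
  e*∣weight∣≤u/[1+j]² k j offset≡ = begin
    e′ * ∣ weight k ∣  ≡⟨ cong (e′ *_) (∣weight∣≡ k 0<d) ⟩
    e′ * (c * 1/d)     ≡⟨ sym (*-assoc e′ c 1/d) ⟩
    e′ * c * 1/d       ≤⟨ *1/-≤ 0<d e′c≤ ⟩
    u * (l * l)        ∎
    where
    open ≤-Reasoning
    e′ = ℕ→ℚ e
    a = ℕ→ℚ (suc j)
    l = 1/[1+ j ]
    c = ℕ→ℚ ((D ℕ.+ D) C k)
    E = e′ * (a * a)
    0<d : 0ℚ < denom k
    0<d = <-≤-trans (*-pos (ℕ→ℚ-pos 1≤e) (*-pos (ℕ→ℚ-pos {suc j} (s≤s z≤n)) (ℕ→ℚ-pos {suc j} (s≤s z≤n))))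
                    (e*offset²≤denom k j offset≡)
    1/d = (1/ denom k) {{>-nonZero 0<d}}
    regroup : ∀ e u a l → e * u * ((a * l) * (a * l)) ≡ u * (l * l * (e * (a * a)))
    regroup = solve-∀ ℚ-ring
    e′u≡ : e′ * u ≡ u * (l * l * E)
    e′u≡ = trans (sym (*-identityʳ (e′ * u)))
                 (trans (cong (λ t → e′ * u * (t * t)) (sym ([1+n]*1/[1+n]≡1 j))) (regroup e′ u a l))
    0≤l² : 0ℚ ≤ l * l
    0≤l² = *-nonNeg (<⇒≤ (1/[1+n]-pos j)) (<⇒≤ (1/[1+n]-pos j))
    e′c≤ : e′ * c ≤ u * (l * l) * denom k
    e′c≤ = begin
      e′ * c                  ≤⟨ *-monoˡ-≤ (ℕ→ℚ-nonNeg e) (ℕ→ℚ-mono-≤ ([2D]Ck≤[2D]CD D k)) ⟩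
      e′ * u                  ≡⟨ e′u≡ ⟩
      u * (l * l * E)         ≤⟨ *-monoˡ-≤ u-nonNeg (*-monoˡ-≤ 0≤l² (e*offset²≤denom k j offset≡)) ⟩
      u * (l * l * denom k)   ≡⟨ sym (*-assoc u (l * l) (denom k)) ⟩
      u * (l * l) * denom k   ∎

  e*∣weight∣≤weightBound : ∀ k → ℕ→ℚ e * ∣ weight k ∣ ≤ weightBound (offset k)
  e*∣weight∣≤weightBound k = by-offset (offset k) refl
    where
    by-offset : ∀ m → offset k ≡ m → ℕ→ℚ e * ∣ weight k ∣ ≤ weightBound m
    by-offset zero    offset≡0 = subst (λ i → ℕ→ℚ e * ∣ weight i ∣ ≤ ℕ→ℚ e * u) (sym (ℕ.∣m-n∣≡0⇒m≡n {k} {D} offset≡0))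
                                       (≤-reflexive (cong (ℕ→ℚ e *_) ∣weight-D∣))
    by-offset (suc j) offset≡  = e*∣weight∣≤u/[1+j]² k j offset≡

  e*∑∣weight∣≤[e+4]u : ℕ→ℚ e * ∑[ k < N ] ∣ weight k ∣ ≤ (ℕ→ℚ e + ℕ→ℚ 4) * u
  e*∑∣weight∣≤[e+4]u = begin
    ℕ→ℚ e * ∑[ k < N ] ∣ weight k ∣                 ≡⟨ sym (∑-*ˡ N (ℕ→ℚ e) (λ k → ∣ weight k ∣)) ⟩
    ∑[ k < N ] (ℕ→ℚ e * ∣ weight k ∣)               ≤⟨ ∑-mono-≤ N e*∣weight∣≤weightBound ⟩
    ∑[ k < N ] weightBound (offset k)               ≡⟨ ∑-distance D weightBound ⟩
    ℕ→ℚ e * u + (S + S)                             ≡⟨ cong (λ t → ℕ→ℚ e * u + (t + t)) (∑-*ˡ D u (λ j → 1/[1+ j ] * 1/[1+ j ])) ⟩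
    ℕ→ℚ e * u + (u * B + u * B)                     ≤⟨ +-monoʳ-≤ (ℕ→ℚ e * u) (+-mono-≤ u*B≤ u*B≤) ⟩
    ℕ→ℚ e * u + (u * ℕ→ℚ 2 + u * ℕ→ℚ 2)             ≡⟨ collect (ℕ→ℚ e) u ⟩
    (ℕ→ℚ e + ℕ→ℚ 4) * u                             ∎
    where
    open ≤-Reasoning
    S = ∑[ j < D ] (u * (1/[1+ j ] * 1/[1+ j ]))
    B = ∑[ j < D ] (1/[1+ j ] * 1/[1+ j ])
    u*B≤ : u * B ≤ u * ℕ→ℚ 2
    u*B≤ = *-monoˡ-≤ u-nonNeg (∑1/[1+j]²≤2 D)
    collect : ∀ e u → e * u + (u * ℕ→ℚ 2 + u * ℕ→ℚ 2) ≡ (e + ℕ→ℚ 4) * u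
    collect = solve-∀ ℚ-ring

  u≤∑∣weight∣ : u ≤ ∑[ k < N ] ∣ weight k ∣
  u≤∑∣weight∣ = subst (_≤ ∑[ k < N ] ∣ weight k ∣) ∣weight-D∣ (∑-term-≤ N (λ k → 0≤∣p∣ (weight k)) (s≤s (ℕ.m≤m+n D D)))

  2u-∑∣weight∣≤-ω2 : u + u - ∑[ k < N ] ∣ weight k ∣ ≤ - ω 2
  2u-∑∣weight∣≤-ω2 = begin
    u + u - A                     ≡⟨ regroup u A ⟩
    (u - - u) - A                 ≡⟨ cong₂ (λ a b → (a - b) - A) (sym ∣weight-D∣) (sym weight-D) ⟩
    (∣ weight D ∣ - weight D) - A  ≤⟨ +-monoˡ-≤ (- A) (subst (∣ weight D ∣ - weight D ≤_) (∑-- N (λ k → ∣ weight k ∣) weight)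
                                                  (∑-term-≤ N (λ k → 0≤∣p∣-p (weight k)) (s≤s (ℕ.m≤m+n D D)))) ⟩
    (A - W) - A                   ≡⟨ cancel A W ⟩
    - W                           ≡⟨ cong -_ (sym ω-at-2) ⟩
    - ω 2                         ∎
    where
    open ≤-Reasoning
    A = ∑[ k < N ] ∣ weight k ∣
    W = ∑[ k < N ] weight k
    regroup : ∀ u A → u + u - A ≡ (u - - u) - A
    regroup = solve-∀ ℚ-ring
    cancel : ∀ A W → (A - W) - A ≡ - W
    cancel = solve-∀ ℚ-ring

-- Choice of the parameters

archimedean : ∀ δ → 0ℚ < δ → Σ[ K ∈ ℕ ] 1ℚ ≤ δ * ℕ→ℚ K
archimedean δ@(mkℚ (ℤ.+ suc a) b _) _ =
  suc b , toℚᵘ-cancel-≤ (ℚᵘ.≤-respʳ-≃ (ℚᵘ.≃-sym (toℚᵘ-homo-* δ (ℕ→ℚ (suc b)))) 1≤δK)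
  where
  1≤δK : toℚᵘ 1ℚ ℚᵘ.≤ toℚᵘ δ ℚᵘ.* toℚᵘ (ℕ→ℚ (suc b))
  1≤δK rewrite ℕ→ℚ≡mkℚ (suc b) =
    ℚᵘ.*≤* (subst₂ ℤ._≤_ (sym (trans (ℤ.*-identityˡ _) (cong ℤ.+_ (ℕ.*-identityʳ (suc b)))))
                         (trans (sym (ℤ.pos-* (suc a) (suc b))) (sym (ℤ.*-identityʳ _)))
                         (ℤ.+≤+ (ℕ.m≤n*m (suc b) (suc a))))
archimedean (mkℚ (ℤ.+ zero) _ _) 0<δ = ⊥-elim (ℤ.Positive.pos (positive 0<δ))
archimedean (mkℚ ℤ.-[1+ _ ] _ _) 0<δ = ⊥-elim (ℤ.Positive.pos (positive 0<δ))

largest : ∀ {P : ℕ → Set} → Decidable P → P 0 → ∀ n → Σ[ m ∈ ℕ ] m ≤ℕ n × P m × (∀ k → k ≤ℕ n → P k → k ≤ℕ m)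
largest P? P0 zero = 0 , z≤n , P0 , λ k k≤0 _ → k≤0
largest P? P0 (suc n) with P? (suc n) | largest P? P0 n
... | yes P[1+n] | _                 = suc n , ℕ.≤-refl , P[1+n] , λ k k≤1+n _ → k≤1+n
... | no ¬P[1+n] | m , m≤n , Pm , max = m , ℕ.m≤n⇒m≤1+n m≤n , Pm , max′
  where
  max′ : ∀ k → k ≤ℕ suc n → _ → k ≤ℕ m
  max′ k k≤1+n Pk with ℕ.m≤n⇒m<n∨m≡n k≤1+n
  ... | inj₁ k<1+n = max k (ℕ.≤-pred k<1+n) Pk
  ... | inj₂ refl  = contradiction Pk ¬P[1+n]

choose-e : ∀ {δ} → 0ℚ < δ → δ < 1ℚ → Σ[ e ∈ ℕ ] 1 ≤ℕ e × ℕ→ℚ 8 ≤ δ * ℕ→ℚ e × δ * ℕ→ℚ (suc e) ≤ ℕ→ℚ 10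
choose-e {δ} 0<δ δ<1 =
  let K , 1≤δK              = archimedean δ 0<δ
      m , m≤8K , δm<8 , max = largest (λ m → δ * ℕ→ℚ m <? ℕ→ℚ 8) small-0 (8 ℕ.* K)
      m<8K                  = ℕ.≤∧≢⇒< m≤8K (λ m≡8K → <-irrefl refl (<-≤-trans (subst Small m≡8K δm<8) (8≤δ[8K] K 1≤δK)))
  in suc m , s≤s z≤n , ≮⇒≥ (λ δ[1+m]<8 → ℕ.<-irrefl refl (max (suc m) m<8K δ[1+m]<8)) , δ[2+m]≤10 m δm<8
  where
  open ≤-Reasoning
  Small : ℕ → Set
  Small m = δ * ℕ→ℚ m < ℕ→ℚ 8
  small-0 : Small 0
  small-0 = subst (_< ℕ→ℚ 8) (sym (*-zeroʳ δ)) (ℕ→ℚ-pos {8} (s≤s z≤n))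
  x*[y*z]≡y*[x*z] : ∀ x y z → x * (y * z) ≡ y * (x * z)
  x*[y*z]≡y*[x*z] = solve-∀ ℚ-ring
  8≤δ[8K] : ∀ K → 1ℚ ≤ δ * ℕ→ℚ K → ℕ→ℚ 8 ≤ δ * ℕ→ℚ (8 ℕ.* K)
  8≤δ[8K] K 1≤δK = begin
    ℕ→ℚ 8                 ≡⟨ sym (*-identityʳ (ℕ→ℚ 8)) ⟩
    ℕ→ℚ 8 * 1ℚ            ≤⟨ *-monoˡ-≤ (ℕ→ℚ-nonNeg 8) 1≤δK ⟩
    ℕ→ℚ 8 * (δ * ℕ→ℚ K)   ≡⟨ x*[y*z]≡y*[x*z] (ℕ→ℚ 8) δ (ℕ→ℚ K) ⟩
    δ * (ℕ→ℚ 8 * ℕ→ℚ K)   ≡⟨ cong (δ *_) (sym (ℕ→ℚ-* 8 K)) ⟩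
    δ * ℕ→ℚ (8 ℕ.* K)     ∎
  expand : ∀ d x → d * (ℕ→ℚ 2 + x) ≡ d * x + ℕ→ℚ 2 * d
  expand = solve-∀ ℚ-ring
  δ[2+m]≤10 : ∀ m → Small m → δ * ℕ→ℚ (suc (suc m)) ≤ ℕ→ℚ 10
  δ[2+m]≤10 m δm<8 = begin
    δ * ℕ→ℚ (2 ℕ.+ m)       ≡⟨ cong (δ *_) (ℕ→ℚ-+ 2 m) ⟩
    δ * (ℕ→ℚ 2 + ℕ→ℚ m)     ≡⟨ expand δ (ℕ→ℚ m) ⟩
    δ * ℕ→ℚ m + ℕ→ℚ 2 * δ   ≤⟨ +-mono-≤ (<⇒≤ δm<8) (*-monoˡ-≤ (ℕ→ℚ-nonNeg 2) (<⇒≤ δ<1)) ⟩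
    ℕ→ℚ 8 + ℕ→ℚ 2 * 1ℚ      ≡⟨ refl ⟩
    ℕ→ℚ 10                  ∎

choose-D : ∀ e L → 1 ≤ℕ L →
           Σ[ D ∈ ℕ ] suc (suc e ℕ.* (D ℕ.* D)) ≤ℕ L × (∀ d → suc (suc e ℕ.* (d ℕ.* d)) ≤ℕ L → d ≤ℕ D)
choose-D e L 1≤L = from-largest (largest (λ d → suc (suc e ℕ.* (d ℕ.* d)) ℕ.≤? L) fits-0 L)
  where
  Fits : ℕ → Set
  Fits d = suc (suc e ℕ.* (d ℕ.* d)) ≤ℕ L
  fits-0 : Fits 0
  fits-0 = subst (λ z → suc z ≤ℕ L) (sym (ℕ.*-zeroʳ (suc e))) 1≤L
  d≤fits : ∀ d → d ≤ℕ suc (suc e ℕ.* (d ℕ.* d))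
  d≤fits zero    = z≤n
  d≤fits (suc d) = ℕ.≤-trans (ℕ.m≤m*n (suc d) (suc d)) (ℕ.≤-trans (ℕ.m≤n*m (suc d ℕ.* suc d) (suc e)) (ℕ.n≤1+n _))
  from-largest : Σ[ D ∈ ℕ ] D ≤ℕ L × Fits D × (∀ d → d ≤ℕ L → Fits d → d ≤ℕ D) →
                 Σ[ D ∈ ℕ ] Fits D × (∀ d → Fits d → d ≤ℕ D)
  from-largest (D , _ , D-fits , max) = D , D-fits , λ d fits → max d (ℕ.≤-trans (d≤fits d) fits) fits

ζ : ℚ
ζ = ℤ.+ 1 / 5

degree-fits : ∀ {δ e L d} → 0ℚ ≤ δ → δ * ℕ→ℚ (suc e) ≤ ℕ→ℚ 10 → 2 ≤ℕ L →
              ℕ→ℚ d * ℕ→ℚ d ≤ ζ * ζ * (δ * ℕ→ℚ L) → suc (suc e ℕ.* (d ℕ.* d)) ≤ℕ L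
degree-fits {δ} {e} {L} {d} 0≤δ δc≤10 2≤L d²≤ = ℕ→ℚ-cancel-≤ (begin
  ℕ→ℚ (suc (suc e ℕ.* (d ℕ.* d)))         ≡⟨ ℕ→ℚ-1+c*n² (suc e) d ⟩
  c * (ℕ→ℚ d * ℕ→ℚ d) + 1ℚ                 ≤⟨ +-monoˡ-≤ 1ℚ (*-monoˡ-≤ (ℕ→ℚ-nonNeg (suc e)) d²≤) ⟩
  c * (ζ * ζ * (δ * l)) + 1ℚ               ≡⟨ cong (_+ 1ℚ) (regroup c δ l) ⟩
  ζ * ζ * (δ * c) * l + 1ℚ                 ≤⟨ +-monoˡ-≤ 1ℚ (*-monoʳ-≤ (ℕ→ℚ-nonNeg L) (*-monoˡ-≤-nonNeg (ζ * ζ) δc≤10)) ⟩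
  ζ * ζ * ℕ→ℚ 10 * l + 1ℚ                  ≤⟨ ≤-by (ℤ.+ 3 / 5 * (l - ℕ→ℚ 2) + ζ) slack-nonNeg (slack l) ⟩
  l                                        ∎)
  where
  open ≤-Reasoning
  c = ℕ→ℚ (suc e)
  l = ℕ→ℚ L
  regroup : ∀ c δ l → c * (ζ * ζ * (δ * l)) ≡ ζ * ζ * (δ * c) * l
  regroup = solve-∀ ℚ-ring
  slack : ∀ l → ζ * ζ * ℕ→ℚ 10 * l + 1ℚ + (ℤ.+ 3 / 5 * (l - ℕ→ℚ 2) + ζ) ≡ l
  slack = solve-∀ ℚ-ring
  slack-nonNeg : 0ℚ ≤ ℤ.+ 3 / 5 * (l - ℕ→ℚ 2) + ζ
  slack-nonNeg = +-nonNeg {ℤ.+ 3 / 5 * (l - ℕ→ℚ 2)} {ζ}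
                          (*-nonNeg {ℤ.+ 3 / 5} (≤ᵇ⇒≤ tt) (p≤q⇒0≤q-p (ℕ→ℚ-mono-≤ 2≤L))) (≤ᵇ⇒≤ tt)

-- Normalisation

half-mass-bound : ∀ {δ e u A M} → 0ℚ ≤ δ → δ ≤ 1ℚ → 0ℚ < e → 0ℚ ≤ u → ℕ→ℚ 8 ≤ δ * e →
                  e * A ≤ (e + ℕ→ℚ 4) * u → M ≤ A + A → ½ * (1ℚ - δ) * M ≤ u + u - A
half-mass-bound {δ} {e} {u} {A} {M} 0≤δ δ≤1 0<e 0≤u 8≤δe eA≤ M≤2A = begin
  ½ * (1ℚ - δ) * M          ≤⟨ *-monoˡ-≤ 0≤½[1-δ] M≤2A ⟩
  ½ * (1ℚ - δ) * (A + A)    ≡⟨ halve δ A ⟩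
  (1ℚ - δ) * A              ≤⟨ *-cancelˡ-≤-pos e {{positive 0<e}} (≤-by slack slack-nonNeg (identity δ e u A)) ⟩
  u + u - A                 ∎
  where
  open ≤-Reasoning
  0≤½[1-δ] : 0ℚ ≤ ½ * (1ℚ - δ)
  0≤½[1-δ] = *-nonNeg {½} (≤ᵇ⇒≤ tt) (p≤q⇒0≤q-p δ≤1)
  halve : ∀ δ A → ½ * (1ℚ - δ) * (A + A) ≡ (1ℚ - δ) * A
  halve = solve-∀ ℚ-ring
  slack = (ℕ→ℚ 2 - δ) * ((e + ℕ→ℚ 4) * u - e * A) + (δ * e - ℕ→ℚ 8) * u + ℕ→ℚ 4 * δ * u
  slack-nonNeg : 0ℚ ≤ slack
  slack-nonNeg = +-nonNeg (+-nonNeg (*-nonNeg (p≤q⇒0≤q-p (≤-trans δ≤1 (≤ᵇ⇒≤ {1ℚ} {ℕ→ℚ 2} tt))) (p≤q⇒0≤q-p eA≤))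
                                    (*-nonNeg (p≤q⇒0≤q-p 8≤δe) 0≤u))
                          (*-nonNeg (*-nonNeg (ℕ→ℚ-nonNeg 4) 0≤δ) 0≤u)
  identity : ∀ δ e u A →
             e * ((1ℚ - δ) * A) + ((ℕ→ℚ 2 - δ) * ((e + ℕ→ℚ 4) * u - e * A) + (δ * e - ℕ→ℚ 8) * u + ℕ→ℚ 4 * δ * u)
             ≡ e * (u + u - A)
  identity = solve-∀ ℚ-ring

IsDualPolynomial : ℚ → ℕ → (ℕ → Set) → (ℕ → ℚ) → Set
IsDualPolynomial δ L Allowed ω = (½ * (1ℚ - δ) ≤ ω 1) × (½ * (1ℚ - δ) ≤ - ω 2) × (sum1to L (λ k → ∣ ω k ∣) ≡ 1ℚ) ×
  ((d : ℕ) → Allowed d → (cs : Vec ℚ (suc d)) → sum1to L (λ k → evalPoly cs (ℕ→ℚ k) * ω k) ≡ 0ℚ)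

restrict-degrees : ∀ {δ L ω} {P Q : ℕ → Set} → (∀ d → P d → Q d) → IsDualPolynomial δ L Q ω → IsDualPolynomial δ L P ω
restrict-degrees P⇒Q (ω1 , ω2 , mass , orthogonal) = ω1 , ω2 , mass , λ d Pd → orthogonal d (P⇒Q d Pd)

dual-polynomial : ∀ {δ} e D L → 1 ≤ℕ e → 0ℚ ≤ δ → δ ≤ 1ℚ → ℕ→ℚ 8 ≤ δ * ℕ→ℚ e → 2 ≤ℕ L →
                  suc (suc e ℕ.* (D ℕ.* D)) ≤ℕ L → Σ[ ω ∈ (ℕ → ℚ) ] IsDualPolynomial δ L (ℕ._≤ D) ω
dual-polynomial {δ} e D L 1≤e 0≤δ δ≤1 8≤δe 2≤L D-fits = (λ x → ω x * 1/M) , at-1 , at-2 , mass , orthogonal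
  where
  open DualPolynomial e D 1≤e
  nodes≤L : ∀ k → k ℕ.< N → node k ≤ℕ L
  nodes≤L k k<N = ℕ.≤-trans (node≤ k k<N) D-fits
  M A : ℚ
  M = sum1to L (λ x → ∣ ω x ∣)
  A = ∑[ k < N ] ∣ weight k ∣
  0<u : 0ℚ < u
  0<u = ℕ→ℚ-pos (nCk>0 (ℕ.m≤m+n D D))
  u≤M : u ≤ M
  u≤M = subst₂ _≤_ (trans (cong ∣_∣ ω-at-1) (0≤p⇒∣p∣≡p (<⇒≤ 0<u))) (sym (sum1to≡∑ L (λ x → ∣ ω x ∣)))
               (∑-term-≤ L (λ x → 0≤∣p∣ (ω (suc x))) {0} (ℕ.≤-trans (s≤s z≤n) 2≤L))
  0<M : 0ℚ < M
  0<M = <-≤-trans 0<u u≤M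
  1/M = (1/ M) {{>-nonZero 0<M}}
  key : ½ * (1ℚ - δ) * M ≤ u + u - A
  key = half-mass-bound 0≤δ δ≤1 (ℕ→ℚ-pos 1≤e) (<⇒≤ 0<u) 8≤δe e*∑∣weight∣≤[e+4]u (sum1to-∣ω∣≤ L 2≤L nodes≤L)
  at-1 : ½ * (1ℚ - δ) ≤ ω 1 * 1/M
  at-1 = ≤-*1/ 0<M (≤-trans key (≤-trans 2u-A≤u (≤-reflexive (sym ω-at-1))))
    where
    2u-A≤u : u + u - A ≤ u
    2u-A≤u = subst (u + u - A ≤_) (cancel u) (+-monoʳ-≤ (u + u) (neg-antimono-≤ u≤∑∣weight∣))
      where
      cancel : ∀ u → u + u - u ≡ u
      cancel = solve-∀ ℚ-ring
  at-2 : ½ * (1ℚ - δ) ≤ - (ω 2 * 1/M)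
  at-2 = subst (½ * (1ℚ - δ) ≤_) (sym (neg-distribˡ-* (ω 2) 1/M)) (≤-*1/ 0<M (≤-trans key 2u-∑∣weight∣≤-ω2))
  mass : sum1to L (λ x → ∣ ω x * 1/M ∣) ≡ 1ℚ
  mass = begin-equality
    sum1to L (λ x → ∣ ω x * 1/M ∣)   ≡⟨ sum1to-cong L (λ x → trans (∣p*q∣≡∣p∣*∣q∣ (ω x) 1/M) (cong (∣ ω x ∣ *_) ∣1/M∣≡1/M)) ⟩
    sum1to L (λ x → ∣ ω x ∣ * 1/M)   ≡⟨ sum1to-*ʳ L 1/M (λ x → ∣ ω x ∣) ⟩
    M * 1/M                          ≡⟨ *-inverseʳ M {{>-nonZero 0<M}} ⟩
    1ℚ                               ∎
    where
    open ≤-Reasoning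
    ∣1/M∣≡1/M : ∣ 1/M ∣ ≡ 1/M
    ∣1/M∣≡1/M = 0≤p⇒∣p∣≡p (<⇒≤ (1/-pos 0<M))
  orthogonal : ∀ d → d ≤ℕ D → (cs : Vec ℚ (suc d)) → sum1to L (λ x → evalPoly cs (ℕ→ℚ x) * (ω x * 1/M)) ≡ 0ℚ
  orthogonal d d≤D cs = begin-equality
    sum1to L (λ x → evalPoly cs (ℕ→ℚ x) * (ω x * 1/M))   ≡⟨ sum1to-cong L (λ x → sym (*-assoc (evalPoly cs (ℕ→ℚ x)) (ω x) 1/M)) ⟩
    sum1to L (λ x → evalPoly cs (ℕ→ℚ x) * ω x * 1/M)     ≡⟨ sum1to-*ʳ L 1/M (λ x → evalPoly cs (ℕ→ℚ x) * ω x) ⟩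
    sum1to L (λ x → evalPoly cs (ℕ→ℚ x) * ω x) * 1/M     ≡⟨ cong (_* 1/M) (ω-orthogonal L 2≤L nodes≤L d≤D cs) ⟩
    0ℚ * 1/M                                             ≡⟨ *-zeroˡ 1/M ⟩
    0ℚ                                                   ∎
    where open ≤-Reasoning

mainTheorem4 : Σ ℚ λ ζ → (0ℚ < ζ ×
    ((δ : ℚ) → 0ℚ < δ → δ < 1ℚ → (L : ℕ) → 2 ≤ℕ L →
      Σ (ℕ → ℚ) λ ω → ((½ * (1ℚ - δ) ≤ ω 1)
        × (½ * (1ℚ - δ) ≤ - ω 2)
        × (sum1to L (λ k → ∣ ω k ∣) ≡ 1ℚ)
        × ((d : ℕ) → ℕ→ℚ d * ℕ→ℚ d ≤ ζ * ζ * (δ * ℕ→ℚ L) →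
            (cs : Vec ℚ (suc d)) →
            sum1to L (λ k → evalPoly cs (ℕ→ℚ k) * ω k) ≡ 0ℚ))))
mainTheorem4 = ζ , *<* (ℤ.+<+ (s≤s z≤n)) , dual
  where
  dual : ∀ δ → 0ℚ < δ → δ < 1ℚ → ∀ L → 2 ≤ℕ L →
         Σ[ ω ∈ (ℕ → ℚ) ] IsDualPolynomial δ L (λ d → ℕ→ℚ d * ℕ→ℚ d ≤ ζ * ζ * (δ * ℕ→ℚ L)) ω
  dual δ 0<δ δ<1 L 2≤L =
    let e , 1≤e , 8≤δe , δ[1+e]≤10 = choose-e 0<δ δ<1
        D , D-fits , D-max          = choose-D e L (ℕ.≤-trans (s≤s z≤n) 2≤L)
        ω , dual-D                  = dual-polynomial {δ} e D L 1≤e (<⇒≤ 0<δ) (<⇒≤ δ<1) 8≤δe 2≤L D-fits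
        allowed⇒≤D d d²≤            = D-max d (degree-fits {δ} {e} {L} {d} (<⇒≤ 0<δ) δ[1+e]≤10 2≤L d²≤)
    in ω , restrict-degrees {δ} {L} {ω} allowed⇒≤D dual-D
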